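{- Let $n$ be an even positive integer and let $Q\subseteq\mathbb{R}^{n-1}$ be the convex hull of all dual degree partitions $(d^*_1,\ldots,d^*_{n-1})$ of simple graphs on $n$ vertices. Then the facet-defining inequalities of $Q$ are \[ n \geq x_1 \geq x_2 \geq \cdots \geq x_{n-1} \geq 0, \] and the extreme points of $Q$ are the $n$ points \[ \mathbf{a}^{(k)} = (\underbrace{n,\ldots,n}_{k},\underbrace{0,\ldots,0}_{n-1-k}), \quad k=0,\ldots,n-1. \]
   Context: All graphs are simple (undirected, no loops, no multiple edges) on the vertex set $\{1,\ldots,n\}$. The degree $d_i$ of vertex $i$ is its number of neighbors; vertices are labeled so that $n-1\ge d_1\ge\cdots\ge d_n\ge 0$, and $\mathbf{d}=(d_1,\ldots,d_n)$ is the degree partition. The dual degree partition of the graph is $\mathbf{d}^*=(d^*_1,\ldots,d^*_n)$ where $d^*_j=|\{i : d_i\ge j\}|$, so $n\ge d^*_1\ge\cdots\ge d^*_n=0$. Since $d^*_n=0$ always, each dual degree partition is regarded as the point $(d^*_1,\ldots,d^*_{n-1})\in\mathbb{R}^{n-1}$ (the last coordinate is suppressed).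
   Formalization: Q is taken in ℚ^(n−1) instead of ℝ^(n−1): its points, convex-combination weights, the coefficients of the facet inequalities and the points tested for extremality and affine independence are rational. -}

module Defs where

open import Data.Bool using (Bool; true; false; if_then_else_)
open import Data.Nat as ℕ using (ℕ; zero; suc; _∸_; _≡ᵇ_; _<ᵇ_; _≤ᵇ_)
open import Data.Fin using (Fin; toℕ)
open import Data.List using (List; []; _∷_; map; foldr; allFin)
open import Data.Nat.ListAction using (sum)
open import Data.List.Relation.Unary.All using (All)
open import Data.Product using (Σ; ∃; _×_; _,_; proj₁; proj₂)
open import Data.Integer using (+_)
open import Data.Rational using (ℚ; 0ℚ; 1ℚ; _+_; _*_; _-_; -_; _≤_; _<_; _/_)
open import Relation.Binary.PropositionalEquality using (_≡_)
open import Relation.Nullary using (¬_)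

-- Simple graphs on the vertex set Fin n  (vertex i ↔ paper's i+1)

record SimpleGraph (n : ℕ) : Set where
  field
    adj     : Fin n → Fin n → Bool
    symm    : ∀ i j → adj i j ≡ adj j i
    irrefl  : ∀ i → adj i i ≡ false

open SimpleGraph public

degree : ∀ {n} → SimpleGraph n → Fin n → ℕ
degree {n} G i = sum (map (λ j → if adj G i j then 1 else 0) (allFin n))

dualDegree : ∀ {n} → SimpleGraph n → ℕ → ℕ
dualDegree {n} G j = sum (map (λ i → if j ≤ᵇ degree G i then 1 else 0) (allFin n))

-- Rational affine geometry in ℚ^d (points are functions Fin d → ℚ;
-- coordinate j : Fin d is the paper's coordinate x_{j+1})

ℕ→ℚ : ℕ → ℚ
ℕ→ℚ n = + n / 1

Point : ℕ → Set
Point d = Fin d → ℚ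

_≈ₚ_ : ∀ {d} → Point d → Point d → Set
x ≈ₚ y = ∀ j → x j ≡ y j

PSet : ℕ → Set₁
PSet d = Point d → Set

sumℚ : List ℚ → ℚ
sumℚ = foldr _+_ 0ℚ

dot : ∀ {d} → Point d → Point d → ℚ
dot {d} c x = sumℚ (map (λ j → c j * x j) (allFin d))

combo : ∀ {d} → List (ℚ × Point d) → Point d
combo [] j = 0ℚ
combo ((l , p) ∷ ps) j = l * p j + combo ps j

coeffSum : ∀ {d} → List (ℚ × Point d) → ℚ
coeffSum [] = 0ℚ
coeffSum ((l , p) ∷ ps) = l + coeffSum ps

ConvexHull : ∀ {d} → PSet d → PSet d
ConvexHull P x =
  Σ (List (ℚ × Point _)) λ ps →
    All (λ lp → (0ℚ ≤ proj₁ lp) × P (proj₂ lp)) ps ×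
    (coeffSum ps ≡ 1ℚ) × (x ≈ₚ combo ps)

AffinelyIndependent : ∀ {d m} → (Fin m → Point d) → Set
AffinelyIndependent {d} {m} p =
  ∀ (l : Fin m → ℚ) →
    (∀ j → sumℚ (map (λ i → l i * p i j) (allFin m)) ≡ 0ℚ) →
    sumℚ (map l (allFin m)) ≡ 0ℚ →
    ∀ i → l i ≡ 0ℚ

HasAffIndep : ∀ {d} → PSet d → ℕ → Set
HasAffIndep {d} S k =
  Σ (Fin (suc k) → Point d) λ p → (∀ i → S (p i)) × AffinelyIndependent p

HasDim : ∀ {d} → PSet d → ℕ → Set
HasDim S k = HasAffIndep S k × ¬ HasAffIndep S (suc k)

ValidIneq : ∀ {d} → PSet d → Point d → ℚ → Set
ValidIneq S c b = ∀ x → S x → dot c x ≤ b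

FaceOf : ∀ {d} → PSet d → Point d → ℚ → PSet d
FaceOf S c b x = S x × (dot c x ≡ b)

FacetDefining : ∀ {d} → PSet d → Point d → ℚ → Set
FacetDefining S c b =
  ValidIneq S c b × Σ ℕ λ k → HasDim S (suc k) × HasDim (FaceOf S c b) k

ExtremePoint : ∀ {d} → PSet d → Point d → Set
ExtremePoint S x =
  S x × (∀ y z t → S y → S z → 0ℚ < t → t < 1ℚ →
           (∀ j → x j ≡ t * y j + (1ℚ - t) * z j) → y ≈ₚ z)

DualDegreePoint : (n : ℕ) → PSet (n ∸ 1)
DualDegreePoint n x =
  Σ (SimpleGraph n) λ G → ∀ j → x j ≡ ℕ→ℚ (dualDegree G (suc (toℕ j)))

Q : (n : ℕ) → PSet (n ∸ 1)
Q n = ConvexHull (DualDegreePoint n)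

-- the n inequalities  n ≥ x_1,  x_1 ≥ x_2, …, x_{n-2} ≥ x_{n-1},  x_{n-1} ≥ 0,
-- indexed by k = 0,…,n-1 and written as c_k · x ≤ b_k where
-- c_k = e_{k+1} − e_k (with e_0 = e_n = 0, 1-based), b_0 = n, b_k = 0 otherwise.
δ : ℕ → ℕ → ℚ
δ a b = if a ≡ᵇ b then 1ℚ else 0ℚ

ineqCoeff : (n : ℕ) → Fin n → Point (n ∸ 1)
ineqCoeff n k j = δ (toℕ j) (toℕ k) - δ (suc (toℕ j)) (toℕ k)

ineqBound : (n : ℕ) → Fin n → ℚ
ineqBound n k = if toℕ k ≡ᵇ 0 then ℕ→ℚ n else 0ℚ

a : (n : ℕ) → Fin n → Point (n ∸ 1)
a n k j = if toℕ j <ᵇ toℕ k then ℕ→ℚ n else 0ℚ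

module Submission where

-- Write the chain n ≥ x₁ ≥ ⋯ ≥ x_{n-1} ≥ 0 as nonnegativity of the n slacks s_k = x_k − x_{k+1}
-- (x₀ = n, x_n = 0); they always sum to n, and x ↦ s/n identifies ℚ^{n-1} with the hyperplane of
-- weights summing to 1. A dual degree partition is antitone and bounded by n, so its slacks are
-- nonnegative; conversely a⁽ᵏ⁾, whose only nonzero slack is s_k = n, is the dual degree partition
-- of a k-regular graph on n vertices, which exists because n is even. Hence Q is the simplex
-- {s ≥ 0} with vertices a⁽⁰⁾, …, a⁽ⁿ⁻¹⁾ and barycentric coordinates s/n. Its extreme points are
-- its vertices. A valid inequality c·x ≤ b is tight at a vertex set determined by the gaps
-- b − c·a⁽ᵐ⁾ ≥ 0; its face has dimension n − 2 exactly when a single gap is nonzero, and then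
-- c·x ≤ b is a positive multiple of the inequality s_m ≥ 0. The dimension counts rest on the fact
-- that k + 1 points whose slack vectors live on k coordinates are affinely dependent, since k
-- homogeneous linear equations in k + 1 unknowns have a nontrivial solution.

open import Data.Nat.Base using (ℕ; suc)
import Data.Rational.Base as ℚ
open import Defs

module Arithmetic where

  open import Algebra.Bundles using (CommutativeRing)
  open import Data.Bool using (true; false; if_then_else_)
  open import Data.Fin using (Fin; zero; suc; toℕ; punchIn; punchOut)
  open import Data.Fin.Properties using (punchInᵢ≢i; punchIn-punchOut)
  import Data.Integer as ℤ
  import Data.Integer.Properties as ℤ
  open import Data.List using (map; foldr; allFin; tabulate)
  open import Data.List.Properties using (map-tabulate)
  open import Data.Nat as ℕ using (ℕ; zero; suc; _<ᵇ_)
  import Data.Nat.Coprimality as C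
  open import Data.Rational using (ℚ; mkℚ; 0ℚ; 1ℚ; _+_; _*_; _-_; -_; _≤_; _<_; *≤*; *<*; 1/_; NonZero; ≢-nonZero;
    positive; nonNegative)
  open import Data.Rational.Properties
    using (+-*-commutativeRing; +-mono-≤; ≤-refl; ≤-antisym; ≤-trans; ≤-reflexive; +-monoʳ-≤;
           +-identityˡ; +-identityʳ; +-inverseʳ; neg-distrib-+;
           normalize-coprime; *-inverseˡ; *-identityˡ; *-assoc; *-zeroʳ; +-monoˡ-≤; nonNegative⁻¹; positive⁻¹;
           nonNeg*nonNeg⇒nonNeg; pos*pos⇒pos; 1/pos⇒pos; pos⇒nonZero; <⇒≢; <⇒≤; +-monoˡ-<; <-cmp; neg-antimono-≤)
  open import Data.Rational.Solver using (module +-*-Solver)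
  open import Data.Vec.Functional as Vector using (Vector)
  open import Function using (_∘_; id)
  open import Relation.Binary using (tri<; tri≈; tri>)
  open import Relation.Binary.PropositionalEquality
  open import Relation.Nullary using (contradiction)
  open +-*-Solver

  open import Algebra.Properties.Semiring.Sum (CommutativeRing.semiring +-*-commutativeRing) public
    using (sum; sum-syntax; ∑-distrib-+; ∑-comm; sum-cong-≗; sum-replicate-zero; sum-remove;
           *-distribˡ-sum; *-distribʳ-sum)

  <ᵇ-true : ∀ {m n} → m ℕ.< n → (m <ᵇ n) ≡ true
  <ᵇ-true {zero}  {suc n} _           = refl
  <ᵇ-true {suc m} {suc n} (ℕ.s≤s m<n) = <ᵇ-true m<n

  <ᵇ-false : ∀ {m n} → n ℕ.≤ m → (m <ᵇ n) ≡ false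
  <ᵇ-false {m}     {zero}  _           = refl
  <ᵇ-false {suc m} {suc n} (ℕ.s≤s n≤m) = <ᵇ-false n≤m

  ≤ᵇ-true : ∀ {m n} → m ℕ.≤ n → (m ℕ.≤ᵇ n) ≡ true
  ≤ᵇ-true {zero}  _   = refl
  ≤ᵇ-true {suc m} m<n = <ᵇ-true m<n

  ≤ᵇ-false : ∀ {m n} → n ℕ.< m → (m ℕ.≤ᵇ n) ≡ false
  ≤ᵇ-false {suc m} (ℕ.s≤s n≤m) = <ᵇ-false n≤m

  ℕ→ℚ≡mkℚ : ∀ m → ℕ→ℚ m ≡ mkℚ (ℤ.+ m) 0 (C.sym (C.1-coprimeTo m))
  ℕ→ℚ≡mkℚ m = normalize-coprime (C.sym (C.1-coprimeTo m))

  ℕ→ℚ-mono-≤ : ∀ {m n} → m ℕ.≤ n → ℕ→ℚ m ≤ ℕ→ℚ n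
  ℕ→ℚ-mono-≤ {m} {n} m≤n rewrite ℕ→ℚ≡mkℚ m | ℕ→ℚ≡mkℚ n =
    *≤* (subst₂ ℤ._≤_ (sym (ℤ.*-identityʳ (ℤ.+ m))) (sym (ℤ.*-identityʳ (ℤ.+ n))) (ℤ.+≤+ m≤n))

  ℕ→ℚ-pos : ∀ m → 0ℚ < ℕ→ℚ (suc m)
  ℕ→ℚ-pos m rewrite ℕ→ℚ≡mkℚ (suc m) = *<* (subst (ℤ.0ℤ ℤ.<_) (sym (ℤ.*-identityʳ (ℤ.+ suc m))) (ℤ.+<+ ℕ.z<s))

  p≤q⇒0≤q-p : ∀ {p q} → p ≤ q → 0ℚ ≤ q - p
  p≤q⇒0≤q-p {p} {q} p≤q = subst (_≤ q - p) (+-inverseʳ p) (+-monoˡ-≤ (- p) p≤q)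

  p<q⇒0<q-p : ∀ {p q} → p < q → 0ℚ < q - p
  p<q⇒0<q-p {p} {q} p<q = subst (_< q - p) (+-inverseʳ p) (+-monoˡ-< (- p) p<q)

  0≤q⇒p-q≤p : ∀ {p q} → 0ℚ ≤ q → p - q ≤ p
  0≤q⇒p-q≤p {p} {q} q≥0 = subst (p - q ≤_) (+-identityʳ p) (+-monoʳ-≤ p (neg-antimono-≤ q≥0))

  0≡p-q⇒p≡q : ∀ {p q} → 0ℚ ≡ p - q → p ≡ q
  0≡p-q⇒p≡q {p} {q} 0≡p-q = trans (solve 2 (λ p q → p := (p :- q) :+ q) refl p q)
                                   (trans (cong (_+ q) (sym 0≡p-q)) (+-identityˡ q))

  b-p≡b⇒p≡0 : ∀ b p → b - p ≡ b → p ≡ 0ℚ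
  b-p≡b⇒p≡0 b p b-p≡b = trans (solve 2 (λ b p → p := b :- (b :- p)) refl b p) (trans (cong (λ q → b - q) b-p≡b) (+-inverseʳ b))

  ≤∧≢⇒< : ∀ {p q} → p ≤ q → p ≢ q → p < q
  ≤∧≢⇒< {p} {q} p≤q p≢q with <-cmp p q
  ... | tri< p<q _ _ = p<q
  ... | tri≈ _ p≡q _ = contradiction p≡q p≢q
  ... | tri> _ _ q<p = contradiction (≤-antisym p≤q (<⇒≤ q<p)) p≢q

  pos⇒≢0 : ∀ {p} → 0ℚ < p → p ≢ 0ℚ
  pos⇒≢0 p>0 = ≢-sym (<⇒≢ p>0)

  *-nonneg : ∀ {p q} → 0ℚ ≤ p → 0ℚ ≤ q → 0ℚ ≤ p * q
  *-nonneg {p} {q} p≥0 q≥0 = nonNegative⁻¹ (p * q) {{nonNeg*nonNeg⇒nonNeg p {{nonNegative p≥0}} q {{nonNegative q≥0}}}}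

  *-pos : ∀ {p q} → 0ℚ < p → 0ℚ < q → 0ℚ < p * q
  *-pos {p} {q} p>0 q>0 = positive⁻¹ (p * q) {{pos*pos⇒pos p {{positive p>0}} q {{positive q>0}}}}

  1/-pos : ∀ {p} (p>0 : 0ℚ < p) → 0ℚ < (1/ p) {{pos⇒nonZero p {{positive p>0}}}}
  1/-pos {p} p>0 = positive⁻¹ _ {{1/pos⇒pos p {{positive p>0}}}}

  p*q≡0⇒q≡0 : ∀ {p q} → p ≢ 0ℚ → p * q ≡ 0ℚ → q ≡ 0ℚ
  p*q≡0⇒q≡0 {p} {q} p≢0 pq≡0 = begin
    q                  ≡⟨ *-identityˡ q ⟨
    1ℚ * q             ≡⟨ cong (_* q) (*-inverseˡ p) ⟨
    (1/ p) * p * q     ≡⟨ *-assoc (1/ p) p q ⟩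
    (1/ p) * (p * q)   ≡⟨ cong ((1/ p) *_) pq≡0 ⟩
    (1/ p) * 0ℚ        ≡⟨ *-zeroʳ (1/ p) ⟩
    0ℚ                 ∎
    where
    open ≡-Reasoning
    instance
      p-nonZero : NonZero p
      p-nonZero = ≢-nonZero p≢0

  nonneg+nonneg≡0⇒≡0 : ∀ {p q} → 0ℚ ≤ p → 0ℚ ≤ q → p + q ≡ 0ℚ → p ≡ 0ℚ
  nonneg+nonneg≡0⇒≡0 {p} {q} p≥0 q≥0 p+q≡0 = ≤-antisym p≤0 p≥0
    where
    p≤0 : p ≤ 0ℚ
    p≤0 = ≤-trans (≤-reflexive (sym (+-identityʳ p))) (≤-trans (+-monoʳ-≤ p q≥0) (≤-reflexive p+q≡0))

  pos*p+pos*q≡0⇒p≡0 : ∀ {t u p q} → 0ℚ < t → 0ℚ < u → 0ℚ ≤ p → 0ℚ ≤ q → t * p + u * q ≡ 0ℚ → p ≡ 0ℚ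
  pos*p+pos*q≡0⇒p≡0 t>0 u>0 p≥0 q≥0 tp+uq≡0 =
    p*q≡0⇒q≡0 (pos⇒≢0 t>0)
      (nonneg+nonneg≡0⇒≡0 (*-nonneg (<⇒≤ t>0) p≥0) (*-nonneg (<⇒≤ u>0) q≥0) tp+uq≡0)

  foldr-map-allFin : ∀ {A : Set} (_∙_ : A → A → A) (ε : A) {m} (f : Fin m → A) →
                     foldr _∙_ ε (map f (allFin m)) ≡ Vector.foldr _∙_ ε f
  foldr-map-allFin _∙_ ε f = trans (cong (foldr _∙_ ε) (map-tabulate id f)) (foldr-tabulate f)
    where
    foldr-tabulate : ∀ {m} (g : Fin m → _) → foldr _∙_ ε (tabulate g) ≡ Vector.foldr _∙_ ε g
    foldr-tabulate {zero}  g = refl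
    foldr-tabulate {suc m} g = cong (g zero ∙_) (foldr-tabulate (g ∘ suc))

  sumℚ-allFin : ∀ {m} (f : Fin m → ℚ) → sumℚ (map f (allFin m)) ≡ ∑[ i < m ] f i
  sumℚ-allFin = foldr-map-allFin _+_ 0ℚ

  ∑-neg : ∀ {m} (f : Fin m → ℚ) → ∑[ i < m ] (- f i) ≡ - ∑[ i < m ] f i
  ∑-neg {zero}  f = refl
  ∑-neg {suc m} f = trans (cong (- f zero +_) (∑-neg (f ∘ suc))) (sym (neg-distrib-+ (f zero) _))

  ∑-distrib-− : ∀ {m} (f g : Fin m → ℚ) → ∑[ i < m ] (f i - g i) ≡ ∑[ i < m ] f i - ∑[ i < m ] g i
  ∑-distrib-− f g = trans (∑-distrib-+ f (-_ ∘ g)) (cong (sum f +_) (∑-neg g))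

  ∑-single : ∀ {m} (f : Fin (suc m) → ℚ) i → (∀ j → j ≢ i → f j ≡ 0ℚ) → ∑[ j < suc m ] f j ≡ f i
  ∑-single {m} f i f≡0 = begin
    sum f                                     ≡⟨ sum-remove f ⟩
    f i + sum (f ∘ punchIn i)                 ≡⟨ cong (f i +_) (sum-cong-≗ (λ j → f≡0 _ (punchInᵢ≢i i j))) ⟩
    f i + sum {m} (λ _ → 0ℚ)                  ≡⟨ cong (f i +_) (sum-replicate-zero m) ⟩
    f i + 0ℚ                                  ≡⟨ +-identityʳ (f i) ⟩
    f i                                       ∎
    where open ≡-Reasoning

  ∑-telescope : ∀ m (X : ℕ → ℚ) → ∑[ k < m ] (X (toℕ k) - X (suc (toℕ k))) ≡ X 0 - X m
  ∑-telescope zero    X = sym (+-inverseʳ (X 0))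
  ∑-telescope (suc m) X = begin
    (X 0 - X 1) + ∑[ k < m ] (X (suc (toℕ k)) - X (suc (suc (toℕ k))))
      ≡⟨ cong ((X 0 - X 1) +_) (∑-telescope m (X ∘ suc)) ⟩
    (X 0 - X 1) + (X 1 - X (suc m))
      ≡⟨ solve 3 (λ a b c → (a :- b) :+ (b :- c) := a :- c) refl (X 0) (X 1) (X (suc m)) ⟩
    X 0 - X (suc m) ∎
    where open ≡-Reasoning

  ∑-telescope-above : ∀ m i (X : ℕ → ℚ) → i ℕ.< m →
    ∑[ k < m ] (if i <ᵇ toℕ k then X (toℕ k) - X (suc (toℕ k)) else 0ℚ) ≡ X (suc i) - X m
  ∑-telescope-above (suc m) zero    X _ = trans (+-identityˡ _) (∑-telescope m (X ∘ suc))
  ∑-telescope-above (suc m) (suc i) X (ℕ.s≤s i<m) =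
    trans (+-identityˡ _) (∑-telescope-above m i (X ∘ suc) i<m)

  ∑-nonneg : ∀ {m} {f : Fin m → ℚ} → (∀ i → 0ℚ ≤ f i) → 0ℚ ≤ ∑[ i < m ] f i
  ∑-nonneg {zero}  f≥0 = ≤-refl
  ∑-nonneg {suc m} f≥0 = +-mono-≤ (f≥0 zero) (∑-nonneg (f≥0 ∘ suc))

  ∑-nonneg≡0⇒≡0 : ∀ {m} {f : Fin m → ℚ} → (∀ i → 0ℚ ≤ f i) → ∑[ i < m ] f i ≡ 0ℚ → ∀ i → f i ≡ 0ℚ
  ∑-nonneg≡0⇒≡0 {suc m} {f} f≥0 ∑f≡0 = f≡0
    where
    f₀≡0 : f zero ≡ 0ℚ
    f₀≡0 = nonneg+nonneg≡0⇒≡0 (f≥0 zero) (∑-nonneg (f≥0 ∘ suc)) ∑f≡0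
    ∑tail≡0 : ∑[ i < m ] f (suc i) ≡ 0ℚ
    ∑tail≡0 = trans (sym (+-identityˡ _)) (trans (cong (_+ ∑[ i < m ] f (suc i)) (sym f₀≡0)) ∑f≡0)
    f≡0 : ∀ i → f i ≡ 0ℚ
    f≡0 zero    = f₀≡0
    f≡0 (suc i) = ∑-nonneg≡0⇒≡0 (f≥0 ∘ suc) ∑tail≡0 i

  term≤∑-nonneg : ∀ {m} {f : Fin (suc m) → ℚ} → (∀ i → 0ℚ ≤ f i) → ∀ i → f i ≤ ∑[ j < suc m ] f j
  term≤∑-nonneg {f = f} f≥0 i = ≤-trans (≤-reflexive (sym (+-identityʳ (f i))))
    (≤-trans (+-monoʳ-≤ (f i) (∑-nonneg (f≥0 ∘ punchIn i))) (≤-reflexive (sym (sum-remove f))))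

  ∑-nonneg≡term⇒others≡0 : ∀ {m} {f : Fin (suc m) → ℚ} → (∀ i → 0ℚ ≤ f i) → ∀ i → ∑[ j < suc m ] f j ≡ f i →
                       ∀ j → j ≢ i → f j ≡ 0ℚ
  ∑-nonneg≡term⇒others≡0 {f = f} f≥0 i ∑f≡fi j j≢i =
    subst (λ j → f j ≡ 0ℚ) (punchIn-punchOut (j≢i ∘ sym)) (∑-nonneg≡0⇒≡0 (f≥0 ∘ punchIn i) ∑rest≡0 (punchOut (j≢i ∘ sym)))
    where
    ∑rest≡0 : ∑[ j < _ ] f (punchIn i j) ≡ 0ℚ
    ∑rest≡0 = trans (solve 2 (λ a r → r := (a :+ r) :- a) refl (f i) _)
                    (trans (cong (_- f i) (trans (sym (sum-remove f)) ∑f≡fi)) (+-inverseʳ (f i)))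

module LinearAlgebra where

  open import Data.Fin using (Fin; zero; suc; punchIn; punchOut; _≟_)
  open import Data.Fin.Properties using (any?; punchIn-punchOut)
  open import Data.Nat using (zero; suc)
  open import Data.Product using (Σ; ∃; _×_; _,_)
  open import Data.Rational using (ℚ; 0ℚ; 1ℚ; _+_; _*_; _-_; -_; 1/_; NonZero; ≢-nonZero)
  open import Data.Rational.Properties using (*-inverseʳ; *-zeroʳ; *-identityʳ) renaming (_≟_ to _≟ℚ_)
  open import Data.Rational.Solver using (module +-*-Solver)
  open import Function using (_∘_)
  open import Relation.Binary.PropositionalEquality
  open import Relation.Nullary using (yes; no; ¬?)
  open import Relation.Nullary.Decidable using (decidable-stable)
  open Arithmetic
  open +-*-Solver

  NontrivialSolution : ∀ {K m} → (Fin K → Fin m → ℚ) → Set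
  NontrivialSolution {K} {m} E =
    Σ (Fin m → ℚ) λ l → (∃ λ i → l i ≢ 0ℚ) × (∀ e → ∑[ i < m ] (E e i * l i) ≡ 0ℚ)

  ∑-row-operation : ∀ {m} (u v l : Fin m → ℚ) c →
    ∑[ i < m ] ((u i - c * v i) * l i) ≡ ∑[ i < m ] (u i * l i) - c * ∑[ i < m ] (v i * l i)
  ∑-row-operation u v l c = begin
    ∑[ i < _ ] ((u i - c * v i) * l i)
      ≡⟨ sum-cong-≗ (λ i → solve 4 (λ u v l c → (u :- c :* v) :* l := u :* l :- c :* (v :* l)) refl (u i) (v i) (l i) c) ⟩
    ∑[ i < _ ] (u i * l i - c * (v i * l i))
      ≡⟨ ∑-distrib-− (λ i → u i * l i) (λ i → c * (v i * l i)) ⟩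
    ∑[ i < _ ] (u i * l i) - ∑[ i < _ ] (c * (v i * l i))
      ≡⟨ cong (λ t → sum (λ i → u i * l i) - t) (sym (*-distribˡ-sum c (λ i → v i * l i))) ⟩
    ∑[ i < _ ] (u i * l i) - c * ∑[ i < _ ] (v i * l i) ∎
    where open ≡-Reasoning

  zeroColumn-solution : ∀ {K m} (E : Fin K → Fin (suc m) → ℚ) → (∀ e → E e zero ≡ 0ℚ) → NontrivialSolution E
  zeroColumn-solution {m = m} E E·0≡0 = l , (zero , λ ()) , E·l≡0
    where
    l : Fin (suc m) → ℚ
    l zero    = 1ℚ
    l (suc i) = 0ℚ
    E·l≡0 : ∀ e → ∑[ i < suc m ] (E e i * l i) ≡ 0ℚ
    E·l≡0 e = begin
      E e zero * 1ℚ + ∑[ i < m ] (E e (suc i) * 0ℚ)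
        ≡⟨ cong₂ _+_ (trans (*-identityʳ _) (E·0≡0 e)) (trans (sum-cong-≗ (λ i → *-zeroʳ (E e (suc i)))) (sum-replicate-zero m)) ⟩
      0ℚ + 0ℚ ∎
      where open ≡-Reasoning

  eliminate : ∀ {K m} (E : Fin (suc K) → Fin (suc m) → ℚ) e₀ → E e₀ zero ≢ 0ℚ → Fin K → Fin m → ℚ
  eliminate E e₀ p≢0 e i = E (punchIn e₀ e) (suc i) - (E (punchIn e₀ e) zero * 1/_ (E e₀ zero) {{≢-nonZero p≢0}}) * E e₀ (suc i)

  pivot-solution : ∀ {K m} (E : Fin (suc K) → Fin (suc m) → ℚ) e₀ (p≢0 : E e₀ zero ≢ 0ℚ) →
                   NontrivialSolution (eliminate E e₀ p≢0) → NontrivialSolution E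
  pivot-solution {K} {m} E e₀ p≢0 (l′ , (i , l′i≢0) , E′·l′≡0) = l , (suc i , l′i≢0) , E·l≡0
    where
    instance
      p-nonZero : NonZero (E e₀ zero)
      p-nonZero = ≢-nonZero p≢0
    p = E e₀ zero
    S = ∑[ i < m ] (E e₀ (suc i) * l′ i)
    l : Fin (suc m) → ℚ
    l zero    = - (S * 1/ p)
    l (suc i) = l′ i
    E·l≡0 : ∀ e → ∑[ i < suc m ] (E e i * l i) ≡ 0ℚ
    E·l≡0 e with e ≟ e₀
    ... | yes refl = begin
      p * - (S * 1/ p) + S ≡⟨ solve 3 (λ p S q → p :* (:- (S :* q)) :+ S := S :* (con 1ℚ :- p :* q)) refl p S (1/ p) ⟩
      S * (1ℚ - p * 1/ p)  ≡⟨ cong (λ t → S * (1ℚ - t)) (*-inverseʳ p) ⟩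
      S * (1ℚ - 1ℚ)        ≡⟨ *-zeroʳ S ⟩
      0ℚ                   ∎
      where open ≡-Reasoning
    ... | no e≢e₀ = begin
      c * - (S * 1/ p) + T   ≡⟨ cong (c * - (S * 1/ p) +_) T≡ ⟩
      c * - (S * 1/ p) + (c * 1/ p) * S
        ≡⟨ solve 3 (λ c S q → c :* (:- (S :* q)) :+ (c :* q) :* S := con 0ℚ) refl c S (1/ p) ⟩
      0ℚ                     ∎
      where
      open ≡-Reasoning
      e′ = punchOut (e≢e₀ ∘ sym)
      c = E e zero
      T = ∑[ i < m ] (E e (suc i) * l′ i)
      reduced : T - (c * 1/ p) * S ≡ 0ℚ
      reduced = subst (λ e → ∑[ i < m ] (E e (suc i) * l′ i) - (E e zero * 1/ p) * S ≡ 0ℚ)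
                      (punchIn-punchOut (e≢e₀ ∘ sym))
                      (trans (sym (∑-row-operation (E (punchIn e₀ e′) ∘ suc) (E e₀ ∘ suc) l′ (E (punchIn e₀ e′) zero * 1/ p)))
                             (E′·l′≡0 e′))
      T≡ : T ≡ (c * 1/ p) * S
      T≡ = trans (solve 2 (λ t u → t := (t :- u) :+ u) refl T ((c * 1/ p) * S))
                 (trans (cong (_+ (c * 1/ p) * S) reduced) (solve 1 (λ u → con 0ℚ :+ u := u) refl _))

  underdetermined-solution : ∀ K (E : Fin K → Fin (suc K) → ℚ) → NontrivialSolution E
  underdetermined-solution zero    E = (λ _ → 1ℚ) , (zero , λ ()) , λ ()
  underdetermined-solution (suc K) E with any? (λ e → ¬? (E e zero ≟ℚ 0ℚ))
  ... | yes (e₀ , p≢0) = pivot-solution E e₀ p≢0 (underdetermined-solution K (eliminate E e₀ p≢0))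
  ... | no noPivot = zeroColumn-solution E (λ e → decidable-stable (E e zero ≟ℚ 0ℚ) (λ ≢0 → noPivot (e , ≢0)))

module Geometry where

  open import Data.Bool using (if_then_else_)
  open import Data.Fin using (Fin; zero; suc; _≟_)
  open import Data.List using ([]; _∷_; map; allFin)
  open import Data.Nat as ℕ using (ℕ; zero; suc)
  import Data.Nat.Properties as ℕ
  open import Data.Product using (_,_)
  open import Data.Rational using (ℚ; 0ℚ; 1ℚ; _+_; _*_)
  open import Data.Rational.Properties using (*-zeroʳ; *-identityʳ; *-assoc)
  open import Data.Rational.Solver using (module +-*-Solver)
  open import Data.Sum using (inj₁; inj₂)
  open import Function using (_∘_)
  open import Relation.Binary.PropositionalEquality
  open import Relation.Nullary using (yes; no; does; contradiction)
  open Arithmetic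
  open +-*-Solver

  dot≡∑ : ∀ {d} (c x : Point d) → dot c x ≡ ∑[ j < d ] (c j * x j)
  dot≡∑ c x = sumℚ-allFin (λ j → c j * x j)

  dot-cong : ∀ {d} {c c′ x x′ : Point d} → c ≈ₚ c′ → x ≈ₚ x′ → dot c x ≡ dot c′ x′
  dot-cong {c = c} {c′} {x} {x′} c≈c′ x≈x′ =
    trans (dot≡∑ c x) (trans (sum-cong-≗ (λ j → cong₂ _*_ (c≈c′ j) (x≈x′ j))) (sym (dot≡∑ c′ x′)))

  dot-zeroʳ : ∀ {d} (c : Point d) → dot c (λ _ → 0ℚ) ≡ 0ℚ
  dot-zeroʳ {d} c = trans (dot≡∑ c _) (trans (sum-cong-≗ (λ j → *-zeroʳ (c j))) (sum-replicate-zero d))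

  dot-*ˡ : ∀ {d} r (c x : Point d) → dot (λ j → r * c j) x ≡ r * dot c x
  dot-*ˡ {d} r c x = begin
    dot (λ j → r * c j) x          ≡⟨ dot≡∑ (λ j → r * c j) x ⟩
    ∑[ j < d ] (r * c j * x j)     ≡⟨ sum-cong-≗ (λ j → *-assoc r (c j) (x j)) ⟩
    ∑[ j < d ] (r * (c j * x j))   ≡⟨ *-distribˡ-sum r (λ j → c j * x j) ⟨
    r * ∑[ j < d ] (c j * x j)     ≡⟨ cong (r *_) (dot≡∑ c x) ⟨
    r * dot c x                    ∎
    where open ≡-Reasoning

  dot-∑ʳ : ∀ {d m} (c : Point d) (w : Fin m → ℚ) (p : Fin m → Point d) →
           dot c (λ j → ∑[ i < m ] (w i * p i j)) ≡ ∑[ i < m ] (w i * dot c (p i))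
  dot-∑ʳ {d} {m} c w p = begin
    dot c (λ j → ∑[ i < m ] (w i * p i j))       ≡⟨ dot≡∑ c _ ⟩
    ∑[ j < d ] (c j * ∑[ i < m ] (w i * p i j))   ≡⟨ sum-cong-≗ (λ j → *-distribˡ-sum (c j) (λ i → w i * p i j)) ⟩
    ∑[ j < d ] ∑[ i < m ] (c j * (w i * p i j))   ≡⟨ ∑-comm (λ j i → c j * (w i * p i j)) ⟩
    ∑[ i < m ] ∑[ j < d ] (c j * (w i * p i j))
      ≡⟨ sum-cong-≗ (λ i → sum-cong-≗ (λ j → solve 3 (λ c w p → c :* (w :* p) := w :* (c :* p)) refl (c j) (w i) (p i j))) ⟩
    ∑[ i < m ] ∑[ j < d ] (w i * (c j * p i j))   ≡⟨ sum-cong-≗ (λ i → sym (*-distribˡ-sum (w i) (λ j → c j * p i j))) ⟩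
    ∑[ i < m ] (w i * ∑[ j < d ] (c j * p i j))   ≡⟨ sum-cong-≗ (λ i → cong (w i *_) (sym (dot≡∑ c (p i)))) ⟩
    ∑[ i < m ] (w i * dot c (p i))                ∎
    where open ≡-Reasoning

  unit : ∀ {d} → Fin d → Point d
  unit j i = if does (i ≟ j) then 1ℚ else 0ℚ

  dot-unit : ∀ {d} (c : Point d) j → dot c (unit j) ≡ c j
  dot-unit {suc d} c j = trans (dot≡∑ c (unit j)) (trans (∑-single _ j off-j) on-j)
    where
    off-j : ∀ i → i ≢ j → c i * unit j i ≡ 0ℚ
    off-j i i≢j with i ≟ j
    ... | yes i≡j = contradiction i≡j i≢j
    ... | no  _   = *-zeroʳ (c i)
    on-j : c j * unit j j ≡ c j
    on-j with j ≟ j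
    ... | yes _   = *-identityʳ (c j)
    ... | no  j≢j = contradiction refl j≢j

  dot-injectiveˡ : ∀ {d} {c c′ : Point d} → (∀ x → dot c x ≡ dot c′ x) → c ≈ₚ c′
  dot-injectiveˡ {c = c} {c′} same j = trans (sym (dot-unit c j)) (trans (same (unit j)) (dot-unit c′ j))

  coeffSum-map : ∀ {A : Set} {d} (w : A → ℚ) (p : A → Point d) xs →
                 coeffSum (map (λ x → w x , p x) xs) ≡ sumℚ (map w xs)
  coeffSum-map w p []       = refl
  coeffSum-map w p (x ∷ xs) = cong (w x +_) (coeffSum-map w p xs)

  combo-map : ∀ {A : Set} {d} (w : A → ℚ) (p : A → Point d) xs j →
              combo (map (λ x → w x , p x) xs) j ≡ sumℚ (map (λ x → w x * p x j) xs)
  combo-map w p []       j = refl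
  combo-map w p (x ∷ xs) j = cong (w x * p x j +_) (combo-map w p xs j)

  ConvexHull-resp-≈ : ∀ {d} {S : PSet d} {x y} → x ≈ₚ y → ConvexHull S y → ConvexHull S x
  ConvexHull-resp-≈ x≈y (ps , ps∈S , ∑ps≡1 , y≈ps) = ps , ps∈S , ∑ps≡1 , λ j → trans (x≈y j) (y≈ps j)

  ExtremePoint-resp-≈ : ∀ {d} {S : PSet d} {x y} → (∀ {x y} → x ≈ₚ y → S y → S x) →
                        x ≈ₚ y → ExtremePoint S y → ExtremePoint S x
  ExtremePoint-resp-≈ S-resp x≈y (y∈S , extreme) =
    S-resp x≈y y∈S , λ u v t u∈S v∈S t>0 t<1 x≡tu+sv → extreme u v t u∈S v∈S t>0 t<1 (λ j → trans (sym (x≈y j)) (x≡tu+sv j))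

  HasAffIndep-mono : ∀ {d k} {S T : PSet d} → (∀ {x} → S x → T x) → HasAffIndep S k → HasAffIndep T k
  HasAffIndep-mono S⊆T (p , p∈S , indep) = p , S⊆T ∘ p∈S , indep

  HasAffIndep-pred : ∀ {d k} {S : PSet d} → HasAffIndep S (suc k) → HasAffIndep S k
  HasAffIndep-pred {k = k} (p , p∈S , indep) = p ∘ suc , p∈S ∘ suc , indep′
    where
    indep′ : AffinelyIndependent (p ∘ suc)
    indep′ l ∑lp≡0 ∑l≡0 i = indep l₀ ∑l₀p≡0 ∑l₀≡0 (suc i)
      where
      l₀ : Fin (suc (suc k)) → ℚ
      l₀ zero    = 0ℚ
      l₀ (suc i) = l i
      drop-zero : ∀ (f : Fin (suc (suc k)) → ℚ) → f zero ≡ 0ℚ → sumℚ (map f (allFin _)) ≡ sumℚ (map (f ∘ suc) (allFin _))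
      drop-zero f f0≡0 = trans (sumℚ-allFin f)
        (trans (cong (_+ ∑[ i < suc k ] f (suc i)) f0≡0)
        (trans (solve 1 (λ s → con 0ℚ :+ s := s) refl (∑[ i < suc k ] f (suc i))) (sym (sumℚ-allFin (f ∘ suc)))))
      ∑l₀p≡0 : ∀ j → sumℚ (map (λ i → l₀ i * p i j) (allFin _)) ≡ 0ℚ
      ∑l₀p≡0 j = trans (drop-zero (λ i → l₀ i * p i j) (solve 1 (λ x → con 0ℚ :* x := con 0ℚ) refl (p zero j))) (∑lp≡0 j)
      ∑l₀≡0 : sumℚ (map l₀ (allFin _)) ≡ 0ℚ
      ∑l₀≡0 = trans (drop-zero l₀ refl) ∑l≡0

  HasAffIndep-≤ : ∀ {d j k} {S : PSet d} → j ℕ.≤ k → HasAffIndep S k → HasAffIndep S j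
  HasAffIndep-≤ {k = zero}  ℕ.z≤n indep = indep
  HasAffIndep-≤ {k = suc k} {S} j≤k indep with ℕ.m≤n⇒m<n∨m≡n j≤k
  ... | inj₁ (ℕ.s≤s j≤k′) = HasAffIndep-≤ {S = S} j≤k′ (HasAffIndep-pred {S = S} indep)
  ... | inj₂ refl          = indep

  HasDim-unique : ∀ {d j k} {S : PSet d} → HasDim S j → HasDim S k → j ≡ k
  HasDim-unique {j = j} {k} {S} (indepʲ , ¬indepʲ⁺¹) (indepᵏ , ¬indepᵏ⁺¹) =
    ℕ.≤-antisym (ℕ.≮⇒≥ (λ k<j → ¬indepᵏ⁺¹ (HasAffIndep-≤ {S = S} k<j indepʲ)))
                (ℕ.≮⇒≥ (λ j<k → ¬indepʲ⁺¹ (HasAffIndep-≤ {S = S} j<k indepᵏ)))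

module SlackCoordinates where

  open import Data.Bool using (Bool; if_then_else_)
  open import Data.Fin using (Fin; zero; suc; toℕ)
  open import Data.Fin.Properties using (toℕ<n; toℕ-injective)
  open import Data.List using (List; []; _∷_; map)
  open import Data.Nat as ℕ using (ℕ; zero; suc; _<ᵇ_; _≤ᵇ_; _≡ᵇ_)
  import Data.Nat.Properties as ℕ
  open import Data.Product using (_×_; _,_; map₂)
  open import Data.Rational using (ℚ; 0ℚ; 1ℚ; _+_; _*_; _-_)
  open import Data.Rational.Properties using (*-zeroˡ; *-identityˡ; *-distribʳ-+; +-identityˡ; +-identityʳ; +-inverseʳ)
  open import Data.Rational.Solver using (module +-*-Solver)
  open import Function using (_∘_)
  open import Relation.Binary using (Tri; tri<; tri≈; tri>)
  open import Relation.Binary.PropositionalEquality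
  open import Relation.Nullary using (Dec; yes; no; contradiction)
  open Arithmetic
  open +-*-Solver

  extend : ∀ {d} → Point d → ℕ → ℚ
  extend {zero}  x i       = 0ℚ
  extend {suc d} x zero    = x zero
  extend {suc d} x (suc i) = extend (x ∘ suc) i

  -- In the paper's indexing, chain t x is t, x₁, …, x_{n-1}, 0, 0, …, so for t = n the drops slack n x k are
  -- the slacks of n ≥ x₁ ≥ ⋯ ≥ x_{n-1} ≥ 0 (see dot-ineqCoeff). Keeping t free makes slack linear in (t, x).
  chain : ∀ {d} → ℚ → Point d → ℕ → ℚ
  chain t x zero    = t
  chain t x (suc i) = extend x i

  slack : ∀ {d} → ℚ → Point d → Point (suc d)
  slack t x k = chain t x (toℕ k) - chain t x (suc (toℕ k))

  extend-toℕ : ∀ {d} (x : Point d) j → extend x (toℕ j) ≡ x j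
  extend-toℕ x zero    = refl
  extend-toℕ x (suc j) = extend-toℕ (x ∘ suc) j

  extend-length : ∀ {d} (x : Point d) → extend x d ≡ 0ℚ
  extend-length {zero}  x = refl
  extend-length {suc d} x = extend-length (x ∘ suc)

  extend-cong : ∀ {d} {x y : Point d} → x ≈ₚ y → ∀ i → extend x i ≡ extend y i
  extend-cong {zero}  x≈y i       = refl
  extend-cong {suc d} x≈y zero    = x≈y zero
  extend-cong {suc d} x≈y (suc i) = extend-cong (x≈y ∘ suc) i

  extend-zero : ∀ {d} i → extend {d} (λ _ → 0ℚ) i ≡ 0ℚ
  extend-zero {zero}  i       = refl
  extend-zero {suc d} zero    = refl
  extend-zero {suc d} (suc i) = extend-zero {d} i

  extend-linear : ∀ {d} l (x y : Point d) i → extend (λ j → l * x j + y j) i ≡ l * extend x i + extend y i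
  extend-linear {zero}  l x y i       = solve 1 (λ l → con 0ℚ := l :* con 0ℚ :+ con 0ℚ) refl l
  extend-linear {suc d} l x y zero    = refl
  extend-linear {suc d} l x y (suc i) = extend-linear l (x ∘ suc) (y ∘ suc) i

  extend-tabulate : ∀ {d} (f : ℕ → ℚ) i → extend {d} (λ j → f (toℕ j)) i ≡ (if i <ᵇ d then f i else 0ℚ)
  extend-tabulate {zero}  f i       = refl
  extend-tabulate {suc d} f zero    = refl
  extend-tabulate {suc d} f (suc i) = extend-tabulate {d} (f ∘ suc) i

  slack-cong : ∀ {d} t {x y : Point d} → x ≈ₚ y → slack t x ≈ₚ slack t y
  slack-cong t x≈y k = cong₂ _-_ (chain-cong (toℕ k)) (chain-cong (suc (toℕ k)))
    where
    chain-cong : ∀ i → chain t _ i ≡ chain t _ i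
    chain-cong zero    = refl
    chain-cong (suc i) = extend-cong x≈y i

  slack-zero : ∀ {d} → slack {d} 0ℚ (λ _ → 0ℚ) ≈ₚ λ _ → 0ℚ
  slack-zero {d} k = cong₂ _-_ (chain-zero (toℕ k)) (chain-zero (suc (toℕ k)))
    where
    chain-zero : ∀ i → chain {d} 0ℚ (λ _ → 0ℚ) i ≡ 0ℚ
    chain-zero zero    = refl
    chain-zero (suc i) = extend-zero {d} i

  slack-linear : ∀ {d} l s t (x y : Point d) →
                 slack (l * s + t) (λ j → l * x j + y j) ≈ₚ λ k → l * slack s x k + slack t y k
  slack-linear l s t x y k =
    trans (cong₂ _-_ (chain-linear (toℕ k)) (chain-linear (suc (toℕ k))))
          (solve 5 (λ l a b c e → (l :* a :+ c) :- (l :* b :+ e) := l :* (a :- b) :+ (c :- e)) refl l _ _ _ _)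
    where
    chain-linear : ∀ i → chain (l * s + t) (λ j → l * x j + y j) i ≡ l * chain s x i + chain t y i
    chain-linear zero    = refl
    chain-linear (suc i) = extend-linear l x y i

  slack-∑ : ∀ {d m} t (w : Fin m → ℚ) (p : Fin m → Point d) →
            slack (∑[ i < m ] (w i * t)) (λ j → ∑[ i < m ] (w i * p i j)) ≈ₚ
            λ k → ∑[ i < m ] (w i * slack t (p i) k)
  slack-∑ {m = zero}  t w p = slack-zero
  slack-∑ {m = suc m} t w p k =
    trans (slack-linear (w zero) t _ (p zero) _ k)
          (cong (w zero * slack t (p zero) k +_) (slack-∑ t (w ∘ suc) (p ∘ suc) k))

  slack-combo : ∀ {d} t (ps : List (ℚ × Point d)) →
                slack (coeffSum ps * t) (combo ps) ≈ₚ combo (map (map₂ (slack t)) ps)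
  slack-combo t []             k = trans (cong (λ s → slack s _ k) (*-zeroˡ t)) (slack-zero k)
  slack-combo t ((l , p) ∷ ps) k =
    trans (cong (λ s → slack s _ k) (*-distribʳ-+ t l (coeffSum ps)))
          (trans (slack-linear l t _ p (combo ps) k) (cong (l * slack t p k +_) (slack-combo t ps k)))

  ∑-slack : ∀ {d} t (x : Point d) → ∑[ k < suc d ] slack t x k ≡ t
  ∑-slack {d} t x = begin
    ∑[ k < suc d ] slack t x k ≡⟨ ∑-telescope (suc d) (chain t x) ⟩
    t - extend x d             ≡⟨ cong (λ e → t - e) (extend-length x) ⟩
    t - 0ℚ                     ≡⟨ solve 1 (λ t → t :- con 0ℚ := t) refl t ⟩
    t                          ∎
    where open ≡-Reasoning

  slack-reconstruct : ∀ {d} t (x : Point d) j →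
                      ∑[ k < suc d ] (if toℕ j <ᵇ toℕ k then slack t x k else 0ℚ) ≡ x j
  slack-reconstruct {d} t x j = begin
    ∑[ k < suc d ] (if toℕ j <ᵇ toℕ k then slack t x k else 0ℚ)
      ≡⟨ ∑-telescope-above (suc d) (toℕ j) (chain t x) (ℕ.m<n⇒m<1+n (toℕ<n j)) ⟩
    extend x (toℕ j) - extend x d ≡⟨ cong₂ _-_ (extend-toℕ x j) (extend-length x) ⟩
    x j - 0ℚ                      ≡⟨ solve 1 (λ y → y :- con 0ℚ := y) refl (x j) ⟩
    x j                           ∎
    where open ≡-Reasoning

  slack-injective : ∀ {d} s t {x y : Point d} → slack s x ≈ₚ slack t y → x ≈ₚ y
  slack-injective s t {x} {y} same j = begin
    x j                                                      ≡⟨ slack-reconstruct s x j ⟨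
    ∑[ k < _ ] (if toℕ j <ᵇ toℕ k then slack s x k else 0ℚ)
      ≡⟨ sum-cong-≗ (λ k → cong (if toℕ j <ᵇ toℕ k then_else 0ℚ) (same k)) ⟩
    ∑[ k < _ ] (if toℕ j <ᵇ toℕ k then slack t y k else 0ℚ) ≡⟨ slack-reconstruct t y j ⟩
    y j                                                      ∎
    where open ≡-Reasoning

  ∑-δ : ∀ {d} (x : Point d) m → ∑[ j < d ] (δ (toℕ j) m * x j) ≡ extend x m
  ∑-δ {zero}  x m       = refl
  ∑-δ {suc d} x zero    = begin
    1ℚ * x zero + ∑[ j < d ] (0ℚ * x (suc j)) ≡⟨ cong₂ _+_ (*-identityˡ (x zero)) (sum-cong-≗ (λ j → *-zeroˡ (x (suc j)))) ⟩
    x zero + ∑[ j < d ] 0ℚ                    ≡⟨ cong (x zero +_) (sum-replicate-zero d) ⟩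
    x zero + 0ℚ                               ≡⟨ +-identityʳ (x zero) ⟩
    x zero                                    ∎
    where open ≡-Reasoning
  ∑-δ {suc d} x (suc m) =
    trans (cong (_+ ∑[ j < d ] (δ (toℕ j) m * x (suc j))) (*-zeroˡ (x zero))) (trans (+-identityˡ _) (∑-δ (x ∘ suc) m))

  ∑-δ-suc : ∀ {d} (x : Point d) m → ∑[ j < d ] (δ (suc (toℕ j)) m * x j) ≡ chain 0ℚ x m
  ∑-δ-suc {d} x zero    = trans (sum-cong-≗ (λ j → *-zeroˡ (x j))) (sum-replicate-zero d)
  ∑-δ-suc     x (suc m) = ∑-δ x m

  dot-ineqCoeff : ∀ {d} (k : Fin (suc d)) (x : Point d) →
                  dot (ineqCoeff (suc d) k) x ≡ ineqBound (suc d) k - slack (ℕ→ℚ (suc d)) x k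
  dot-ineqCoeff {d} k x = begin
    dot (ineqCoeff (suc d) k) x
      ≡⟨ sumℚ-allFin (λ j → ineqCoeff (suc d) k j * x j) ⟩
    ∑[ j < d ] ((δ (toℕ j) m - δ (suc (toℕ j)) m) * x j)
      ≡⟨ sum-cong-≗ (λ j → solve 3 (λ a b y → (a :- b) :* y := a :* y :- b :* y) refl (δ (toℕ j) m) (δ (suc (toℕ j)) m) (x j)) ⟩
    ∑[ j < d ] (δ (toℕ j) m * x j - δ (suc (toℕ j)) m * x j)
      ≡⟨ ∑-distrib-− (λ j → δ (toℕ j) m * x j) (λ j → δ (suc (toℕ j)) m * x j) ⟩
    ∑[ j < d ] (δ (toℕ j) m * x j) - ∑[ j < d ] (δ (suc (toℕ j)) m * x j)
      ≡⟨ cong₂ _-_ (∑-δ x m) (∑-δ-suc x m) ⟩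
    extend x m - chain 0ℚ x m
      ≡⟨ bound-minus-slack m ⟩
    ineqBound (suc d) k - slack (ℕ→ℚ (suc d)) x k ∎
    where
    open ≡-Reasoning
    m = toℕ k
    bound-minus-slack : ∀ m → extend x m - chain 0ℚ x m ≡
      (if m ≡ᵇ 0 then ℕ→ℚ (suc d) else 0ℚ) - (chain (ℕ→ℚ (suc d)) x m - extend x m)
    bound-minus-slack zero    = solve 2 (λ n e → e :- con 0ℚ := n :- (n :- e)) refl (ℕ→ℚ (suc d)) (extend x 0)
    bound-minus-slack (suc m) = solve 2 (λ a b → b :- a := con 0ℚ :- (a :- b)) refl (extend x m) (extend x (suc m))

  chain-a : ∀ {d} (i : Fin (suc d)) m →
            chain (ℕ→ℚ (suc d)) (a (suc d) i) m ≡ (if m ≤ᵇ toℕ i then ℕ→ℚ (suc d) else 0ℚ)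
  chain-a         i zero    = refl
  chain-a {d} i (suc m) = trans (extend-tabulate {d} (λ t → if t <ᵇ toℕ i then ℕ→ℚ (suc d) else 0ℚ) m)
                               (beyond (m ℕ.<? d))
    where
    beyond : Dec (m ℕ.< d) → (if m <ᵇ d then (if m <ᵇ toℕ i then ℕ→ℚ (suc d) else 0ℚ) else 0ℚ) ≡
                             (if m <ᵇ toℕ i then ℕ→ℚ (suc d) else 0ℚ)
    beyond (yes m<d) = cong (if_then (if m <ᵇ toℕ i then ℕ→ℚ (suc d) else 0ℚ) else 0ℚ) (<ᵇ-true m<d)
    beyond (no m≮d)  = trans (cong (if_then (if m <ᵇ toℕ i then ℕ→ℚ (suc d) else 0ℚ) else 0ℚ) (<ᵇ-false (ℕ.≮⇒≥ m≮d)))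
                             (cong (if_then ℕ→ℚ (suc d) else 0ℚ) (sym (<ᵇ-false (ℕ.≤-trans (ℕ.≤-pred (toℕ<n i)) (ℕ.≮⇒≥ m≮d)))))

  slack-a : ∀ {d} (i k : Fin (suc d)) → slack (ℕ→ℚ (suc d)) (a (suc d) i) k ≡
            (if toℕ k ≤ᵇ toℕ i then ℕ→ℚ (suc d) else 0ℚ) - (if toℕ k <ᵇ toℕ i then ℕ→ℚ (suc d) else 0ℚ)
  slack-a i k = cong₂ _-_ (chain-a i (toℕ k)) (chain-a i (suc (toℕ k)))

  slack-a-≡ : ∀ {d} (i : Fin (suc d)) → slack (ℕ→ℚ (suc d)) (a (suc d) i) i ≡ ℕ→ℚ (suc d)
  slack-a-≡ {d} i = begin
    slack (ℕ→ℚ (suc d)) (a (suc d) i) i ≡⟨ slack-a i i ⟩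
    (if toℕ i ≤ᵇ toℕ i then ℕ→ℚ (suc d) else 0ℚ) - (if toℕ i <ᵇ toℕ i then ℕ→ℚ (suc d) else 0ℚ)
      ≡⟨ cong₂ (λ b c → (if b then ℕ→ℚ (suc d) else 0ℚ) - (if c then ℕ→ℚ (suc d) else 0ℚ))
               (≤ᵇ-true (ℕ.≤-refl {toℕ i})) (<ᵇ-false (ℕ.≤-refl {toℕ i})) ⟩
    ℕ→ℚ (suc d) - 0ℚ ≡⟨ solve 1 (λ n → n :- con 0ℚ := n) refl (ℕ→ℚ (suc d)) ⟩
    ℕ→ℚ (suc d) ∎
    where open ≡-Reasoning

  slack-a-≢ : ∀ {d} (i k : Fin (suc d)) → k ≢ i → slack (ℕ→ℚ (suc d)) (a (suc d) i) k ≡ 0ℚ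
  slack-a-≢ {d} i k k≢i = trans (slack-a i k) (by-comparison (ℕ.<-cmp (toℕ k) (toℕ i)))
    where
    N = ℕ→ℚ (suc d)
    drop : Bool → Bool → ℚ
    drop b c = (if b then N else 0ℚ) - (if c then N else 0ℚ)
    by-comparison : Tri (toℕ k ℕ.< toℕ i) (toℕ k ≡ toℕ i) (toℕ i ℕ.< toℕ k) →
                    drop (toℕ k ≤ᵇ toℕ i) (toℕ k <ᵇ toℕ i) ≡ 0ℚ
    by-comparison (tri< k<i _ _) = trans (cong₂ drop (≤ᵇ-true (ℕ.<⇒≤ k<i)) (<ᵇ-true k<i)) (+-inverseʳ N)
    by-comparison (tri≈ _ k≡i _) = contradiction (toℕ-injective k≡i) k≢i
    by-comparison (tri> _ _ i<k) = cong₂ drop (≤ᵇ-false i<k) (<ᵇ-false (ℕ.<⇒≤ i<k))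

module RegularGraphs where

  open import Data.Bool using (Bool; true; false; if_then_else_; not; _∧_)
  open import Data.Bool.Properties using (∧-zeroʳ)
  open import Data.Fin using (Fin; zero; suc; toℕ; inject₁; fromℕ)
  open import Data.Fin.Properties using (toℕ<n; toℕ-inject₁; toℕ-fromℕ)
  open import Data.Nat
  open import Data.Nat.DivMod using (_%_; m<n⇒m%n≡m; n%n≡0; %-distribˡ-+; m%n%n≡m%n)
  open import Data.Nat.Divisibility using (_∣_; divides)
  open import Data.Nat.Properties
  open import Data.Product using (Σ; _,_)
  open import Function using (_∘_)
  open import Relation.Binary.PropositionalEquality
  open import Relation.Nullary using (Dec; yes; no)
  open Arithmetic using (foldr-map-allFin; <ᵇ-true; <ᵇ-false; ≤ᵇ-true; ≤ᵇ-false)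
  open import Algebra.Properties.Semiring.Sum +-*-semiring
    using (sum-syntax; sum-cong-≗; sum-replicate-zero; sum-init-last)

  indicator : Bool → ℕ
  indicator b = if b then 1 else 0

  degree≡∑ : ∀ {n} (G : SimpleGraph n) i → degree G i ≡ ∑[ j < n ] indicator (adj G i j)
  degree≡∑ G i = foldr-map-allFin _+_ 0 (λ j → indicator (adj G i j))

  dualDegree≡∑ : ∀ {n} (G : SimpleGraph n) j → dualDegree G j ≡ ∑[ i < n ] indicator (j ≤ᵇ degree G i)
  dualDegree≡∑ G j = foldr-map-allFin _+_ 0 (λ i → indicator (j ≤ᵇ degree G i))

  ∑-mono-≤ : ∀ {m} {f g : Fin m → ℕ} → (∀ i → f i ≤ g i) → ∑[ i < m ] f i ≤ ∑[ i < m ] g i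
  ∑-mono-≤ {zero}  f≤g = z≤n
  ∑-mono-≤ {suc m} f≤g = +-mono-≤ (f≤g zero) (∑-mono-≤ (f≤g ∘ suc))

  ∑-const : ∀ m c → ∑[ i < m ] c ≡ m * c
  ∑-const zero    c = refl
  ∑-const (suc m) c = cong (c +_) (∑-const m c)

  indicator≤1 : ∀ b → indicator b ≤ 1
  indicator≤1 true  = s≤s z≤n
  indicator≤1 false = z≤n

  dualDegree≤n : ∀ {n} (G : SimpleGraph n) j → dualDegree G j ≤ n
  dualDegree≤n {n} G j = begin
    dualDegree G j                             ≡⟨ dualDegree≡∑ G j ⟩
    ∑[ i < n ] indicator (j ≤ᵇ degree G i)     ≤⟨ ∑-mono-≤ (λ i → indicator≤1 (j ≤ᵇ degree G i)) ⟩
    ∑[ i < n ] 1                               ≡⟨ ∑-const n 1 ⟩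
    n * 1                                      ≡⟨ *-identityʳ n ⟩
    n                                          ∎
    where open ≤-Reasoning

  dualDegree-suc : ∀ {n} (G : SimpleGraph n) j → dualDegree G (suc j) ≤ dualDegree G j
  dualDegree-suc {n} G j = begin
    dualDegree G (suc j)                        ≡⟨ dualDegree≡∑ G (suc j) ⟩
    ∑[ i < n ] indicator (suc j ≤ᵇ degree G i)  ≤⟨ ∑-mono-≤ (λ i → indicator-≤ᵇ-suc j (degree G i)) ⟩
    ∑[ i < n ] indicator (j ≤ᵇ degree G i)      ≡⟨ dualDegree≡∑ G j ⟨
    dualDegree G j                              ∎
    where
    open ≤-Reasoning
    indicator-≤ᵇ-suc : ∀ j m → indicator (suc j ≤ᵇ m) ≤ indicator (j ≤ᵇ m)
    indicator-≤ᵇ-suc j m with suc j ≤? m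
    ... | yes j<m rewrite ≤ᵇ-true j<m | ≤ᵇ-true (<⇒≤ j<m) = ≤-refl
    ... | no  j≮m rewrite ≤ᵇ-false (≰⇒> j≮m)               = z≤n

  dualDegree-regular : ∀ {n} (G : SimpleGraph n) k → (∀ i → degree G i ≡ k) →
                       ∀ j → dualDegree G (suc j) ≡ (if j <ᵇ k then n else 0)
  dualDegree-regular {n} G k regular j = begin
    dualDegree G (suc j)                        ≡⟨ dualDegree≡∑ G (suc j) ⟩
    ∑[ i < n ] indicator (suc j ≤ᵇ degree G i)  ≡⟨ sum-cong-≗ (λ i → cong (indicator ∘ (suc j ≤ᵇ_)) (regular i)) ⟩
    ∑[ i < n ] indicator (j <ᵇ k)               ≡⟨ ∑-const n (indicator (j <ᵇ k)) ⟩
    n * indicator (j <ᵇ k)                      ≡⟨ n*indicator (j <ᵇ k) ⟩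
    (if j <ᵇ k then n else 0)                   ∎
    where
    open ≡-Reasoning
    n*indicator : ∀ b → n * indicator b ≡ (if b then n else 0)
    n*indicator true  = *-identityʳ n
    n*indicator false = *-zeroʳ n

  ∑-split : ∀ a b (g : ℕ → ℕ) → ∑[ t < a + b ] g (toℕ t) ≡ ∑[ t < a ] g (toℕ t) + ∑[ t < b ] g (a + toℕ t)
  ∑-split zero    b g = refl
  ∑-split (suc a) b g = trans (cong (g 0 +_) (∑-split a b (g ∘ suc))) (sym (+-assoc (g 0) _ _))

  count-below : ∀ m q → ∑[ t < m ] indicator (toℕ t <ᵇ q) ≡ m ⊓ q
  count-below zero    q       = refl
  count-below (suc m) zero    = sum-replicate-zero m
  count-below (suc m) (suc q) = cong suc (count-below m q)

  count-≢ : ∀ h x → x < suc h → ∑[ y < suc h ] indicator (not (x ≡ᵇ toℕ y)) ≡ h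
  count-≢ h       zero    _           = trans (∑-const h 1) (*-identityʳ h)
  count-≢ (suc h) (suc x) (s≤s x<h+1) = cong suc (count-≢ h x x<h+1)

  module _ (h : ℕ) where

    private
      H = suc h

    ∑-rotate-one : ∀ (g : ℕ → ℕ) → ∑[ t < H ] g (suc (toℕ t) % H) ≡ ∑[ t < H ] g (toℕ t)
    ∑-rotate-one g = begin
      ∑[ t < H ] g (suc (toℕ t) % H)                            ≡⟨ sum-init-last (λ t → g (suc (toℕ t) % H)) ⟩
      ∑[ t < h ] g (suc (toℕ (inject₁ t)) % H) + g (suc (toℕ (fromℕ h)) % H)
        ≡⟨ cong₂ _+_ (sum-cong-≗ (λ t → cong g (below-H t))) (cong g (trans (cong (λ m → suc m % H) (toℕ-fromℕ h)) (n%n≡0 H))) ⟩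
      ∑[ t < h ] g (suc (toℕ t)) + g 0                          ≡⟨ +-comm _ (g 0) ⟩
      ∑[ t < H ] g (toℕ t)                                      ∎
      where
      open ≡-Reasoning
      below-H : ∀ (t : Fin h) → suc (toℕ (inject₁ t)) % H ≡ suc (toℕ t)
      below-H t = trans (cong (λ m → suc m % H) (toℕ-inject₁ t)) (m<n⇒m%n≡m (s≤s (toℕ<n t)))

    ∑-rotate : ∀ c (g : ℕ → ℕ) → ∑[ t < H ] g ((toℕ t + c) % H) ≡ ∑[ t < H ] g (toℕ t)
    ∑-rotate zero    g = sum-cong-≗ {H} (λ t → cong g (trans (cong (_% H) (+-identityʳ (toℕ t))) (m<n⇒m%n≡m (toℕ<n t))))
    ∑-rotate (suc c) g = begin
      ∑[ t < H ] g ((toℕ t + suc c) % H)        ≡⟨ sum-cong-≗ {H} (λ t → cong g (shift (toℕ t))) ⟩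
      ∑[ t < H ] g ((suc (toℕ t) % H + c) % H)  ≡⟨ ∑-rotate-one (λ s → g ((s + c) % H)) ⟩
      ∑[ t < H ] g ((toℕ t + c) % H)            ≡⟨ ∑-rotate c g ⟩
      ∑[ t < H ] g (toℕ t)                      ∎
      where
      open ≡-Reasoning
      shift : ∀ m → (m + suc c) % H ≡ (suc m % H + c) % H
      shift m = begin
        (m + suc c) % H                 ≡⟨ cong (_% H) (+-suc m c) ⟩
        (suc m + c) % H                 ≡⟨ %-distribˡ-+ (suc m) c H ⟩
        (suc m % H + c % H) % H         ≡⟨ cong (λ r → (r + c % H) % H) (m%n%n≡m%n (suc m) H) ⟨
        (suc m % H % H + c % H) % H     ≡⟨ %-distribˡ-+ (suc m % H) c H ⟨
        (suc m % H + c) % H             ∎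

    count-cross : ∀ q u → q ≤ H → ∑[ t < H ] indicator ((toℕ t + u) % H <ᵇ q) ≡ q
    count-cross q u q≤H = trans (∑-rotate u (λ s → indicator (s <ᵇ q))) (trans (count-below H q) (m≥n⇒m⊓n≡n q≤H))

  count-≢-if : ∀ b h x → x < suc h → ∑[ y < suc h ] indicator (b ∧ not (x ≡ᵇ toℕ y)) ≡ (if b then h else 0)
  count-≢-if true  h x x<h+1 = count-≢ h x x<h+1
  count-≢-if false h x _     = sum-replicate-zero (suc h)

  ≡ᵇ-refl : ∀ x → (x ≡ᵇ x) ≡ true
  ≡ᵇ-refl zero    = refl
  ≡ᵇ-refl (suc x) = ≡ᵇ-refl x

  ≡ᵇ-sym : ∀ x y → (x ≡ᵇ y) ≡ (y ≡ᵇ x)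
  ≡ᵇ-sym zero    zero    = refl
  ≡ᵇ-sym zero    (suc y) = refl
  ≡ᵇ-sym (suc x) zero    = refl
  ≡ᵇ-sym (suc x) (suc y) = ≡ᵇ-sym x y

  +-≡ᵇ : ∀ m x y → ((m + x) ≡ᵇ (m + y)) ≡ (x ≡ᵇ y)
  +-≡ᵇ zero    x y = refl
  +-≡ᵇ (suc m) x y = +-≡ᵇ m x y

  -- Two copies {0,…,h} and {H,…,H+h} of ℤ/H, each independent or complete, with l joined to H+r
  -- whenever (l + r) mod H < q: every vertex has degree q, plus h if the copies are complete.
  module TwoHalves (h : ℕ) (complete : Bool) (q : ℕ) where

    H : ℕ
    H = suc h

    inner : ℕ → ℕ → Bool
    inner x y = complete ∧ not (x ≡ᵇ y)

    cross : ℕ → ℕ → Bool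
    cross l r = (r + l) % H <ᵇ q

    A : ℕ → ℕ → Bool
    A x y = if x <ᵇ H then (if y <ᵇ H then inner x y else cross x (y ∸ H))
                      else (if y <ᵇ H then cross y (x ∸ H) else inner x y)

    inner-sym : ∀ x y → inner x y ≡ inner y x
    inner-sym x y = cong (λ b → complete ∧ not b) (≡ᵇ-sym x y)

    A-sym : ∀ x y → A x y ≡ A y x
    A-sym x y with x <ᵇ H | y <ᵇ H
    ... | true  | true  = inner-sym x y
    ... | true  | false = refl
    ... | false | true  = refl
    ... | false | false = inner-sym x y

    inner-irrefl : ∀ x → inner x x ≡ false
    inner-irrefl x rewrite ≡ᵇ-refl x = ∧-zeroʳ complete

    A-irrefl : ∀ x → A x x ≡ false
    A-irrefl x with x <ᵇ H
    ... | true  = inner-irrefl x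
    ... | false = inner-irrefl x

    graph : SimpleGraph (H + H)
    graph = record { adj = λ i j → A (toℕ i) (toℕ j) ; symm = λ i j → A-sym (toℕ i) (toℕ j) ; irrefl = λ i → A-irrefl (toℕ i) }

    innerDegree : ℕ
    innerDegree = if complete then h else 0

    count-inner : ∀ u → u < H → ∑[ y < H ] indicator (inner u (toℕ y)) ≡ innerDegree
    count-inner = count-≢-if complete h

    degree-below : ∀ x → x < H → q ≤ H → ∑[ y < H + H ] indicator (A x (toℕ y)) ≡ innerDegree + q
    degree-below x x<H q≤H = begin
      ∑[ y < H + H ] indicator (A x (toℕ y))                               ≡⟨ ∑-split H H (indicator ∘ A x) ⟩
      ∑[ y < H ] indicator (A x (toℕ y)) + ∑[ t < H ] indicator (A x (H + toℕ t))
        ≡⟨ cong₂ _+_ (sum-cong-≗ {H} (λ y → cong indicator (first-half y)))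
                     (sum-cong-≗ {H} (λ t → cong indicator (second-half (toℕ t)))) ⟩
      ∑[ y < H ] indicator (inner x (toℕ y)) + ∑[ t < H ] indicator ((toℕ t + x) % H <ᵇ q)
        ≡⟨ cong₂ _+_ (count-inner x x<H) (count-cross h q x q≤H) ⟩
      innerDegree + q                                                       ∎
      where
      open ≡-Reasoning
      first-half : ∀ (y : Fin H) → A x (toℕ y) ≡ inner x (toℕ y)
      first-half y rewrite <ᵇ-true x<H | <ᵇ-true (toℕ<n y) = refl
      second-half : ∀ t → A x (H + t) ≡ ((t + x) % H <ᵇ q)
      second-half t rewrite <ᵇ-true x<H | <ᵇ-false {H + t} {H} (m≤m+n H t) | m+n∸m≡n H t = refl

    degree-above : ∀ u → u < H → q ≤ H → ∑[ y < H + H ] indicator (A (H + u) (toℕ y)) ≡ innerDegree + q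
    degree-above u u<H q≤H = begin
      ∑[ y < H + H ] indicator (A (H + u) (toℕ y))                         ≡⟨ ∑-split H H (indicator ∘ A (H + u)) ⟩
      ∑[ y < H ] indicator (A (H + u) (toℕ y)) + ∑[ t < H ] indicator (A (H + u) (H + toℕ t))
        ≡⟨ cong₂ _+_ (sum-cong-≗ {H} (λ y → cong indicator (first-half y)))
                     (sum-cong-≗ {H} (λ t → cong indicator (second-half (toℕ t)))) ⟩
      ∑[ y < H ] indicator ((toℕ y + u) % H <ᵇ q) + ∑[ t < H ] indicator (inner u (toℕ t))
        ≡⟨ cong₂ _+_ (count-cross h q u q≤H) (count-inner u u<H) ⟩
      q + innerDegree                                                       ≡⟨ +-comm q innerDegree ⟩
      innerDegree + q                                                       ∎
      where
      open ≡-Reasoning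
      first-half : ∀ (y : Fin H) → A (H + u) (toℕ y) ≡ ((toℕ y + u) % H <ᵇ q)
      first-half y rewrite <ᵇ-false {H + u} {H} (m≤m+n H u) | <ᵇ-true (toℕ<n y) | m+n∸m≡n H u =
        cong (λ m → m % H <ᵇ q) (+-comm u (toℕ y))
      second-half : ∀ t → A (H + u) (H + t) ≡ inner u t
      second-half t rewrite <ᵇ-false {H + u} {H} (m≤m+n H u) | <ᵇ-false {H + t} {H} (m≤m+n H t) =
        cong (λ b → complete ∧ not b) (+-≡ᵇ H u t)

    degree-graph : q ≤ H → ∀ i → degree graph i ≡ innerDegree + q
    degree-graph q≤H i = trans (degree≡∑ graph i) (by-half (toℕ i <? H))
      where
      by-half : Dec (toℕ i < H) → ∑[ y < H + H ] indicator (A (toℕ i) (toℕ y)) ≡ innerDegree + q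
      by-half (yes i<H) = degree-below (toℕ i) i<H q≤H
      by-half (no  i≮H) = subst (λ x → ∑[ y < H + H ] indicator (A x (toℕ y)) ≡ innerDegree + q) (m+[n∸m]≡n H≤i)
                                (degree-above (toℕ i ∸ H) (+-cancelˡ-< H _ H (subst (_< H + H) (sym (m+[n∸m]≡n H≤i)) (toℕ<n i))) q≤H)
        where H≤i = ≮⇒≥ i≮H

  regular-graph : ∀ {n} → 2 ∣ n → ∀ k → k < n → Σ (SimpleGraph n) λ G → ∀ i → degree G i ≡ k
  regular-graph (divides (suc h) refl) k k<n = subst (λ m → k < m → Σ (SimpleGraph m) λ G → ∀ i → degree G i ≡ k)
                                                    2H≡H*2 (on-two-halves (k ≤? h)) k<n
    where
    2H≡H*2 : suc h + suc h ≡ suc h * 2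
    2H≡H*2 = trans (cong (suc h +_) (sym (+-identityʳ (suc h)))) (*-comm 2 (suc h))
    on-two-halves : Dec (k ≤ h) → k < suc h + suc h → Σ (SimpleGraph (suc h + suc h)) λ G → ∀ i → degree G i ≡ k
    on-two-halves (yes k≤h) _   = TwoHalves.graph h false k , TwoHalves.degree-graph h false k (m≤n⇒m≤1+n k≤h)
    on-two-halves (no  k≰h) k<2H = TwoHalves.graph h true (k ∸ h) ,
      λ i → trans (TwoHalves.degree-graph h true (k ∸ h) (m≤n+o⇒m∸n≤o k h (≤-pred k<2H)) i)
                  (m+[n∸m]≡n (<⇒≤ (≰⇒> k≰h)))

module DualDegreePoints where

  open import Data.Bool using (Bool; true; false; if_then_else_)
  open import Data.Fin using (Fin; toℕ)
  open import Data.Fin.Properties using (toℕ<n)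
  open import Data.Nat as ℕ using (ℕ; zero; suc; _<ᵇ_)
  open import Data.Nat.Divisibility using (_∣_)
  import Data.Nat.Properties as ℕ
  open import Data.Product using (_,_; proj₁; proj₂)
  open import Data.Rational using (0ℚ; _≤_; _-_)
  open import Relation.Binary.PropositionalEquality
  open import Relation.Nullary using (yes; no)
  open Arithmetic using (ℕ→ℚ-mono-≤; p≤q⇒0≤q-p; <ᵇ-true; <ᵇ-false)
  open RegularGraphs using (regular-graph; dualDegree≤n; dualDegree-suc; dualDegree-regular)
  open SlackCoordinates

  ℕ→ℚ-if : ∀ b m → ℕ→ℚ (if b then m else 0) ≡ (if b then ℕ→ℚ m else 0ℚ)
  ℕ→ℚ-if true  m = refl
  ℕ→ℚ-if false m = refl

  dualChain : ∀ {d} → SimpleGraph (suc d) → ℕ → ℕ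
  dualChain {d} G zero    = suc d
  dualChain {d} G (suc i) = if i <ᵇ d then dualDegree G (suc i) else 0

  dualChain-antitone : ∀ {d} (G : SimpleGraph (suc d)) i → dualChain G (suc i) ℕ.≤ dualChain G i
  dualChain-antitone {d} G zero with 0 <ᵇ d
  ... | true  = dualDegree≤n G 1
  ... | false = ℕ.z≤n
  dualChain-antitone {d} G (suc i) with suc i ℕ.<? d
  ... | yes i+1<d rewrite <ᵇ-true i+1<d | <ᵇ-true (ℕ.<-trans (ℕ.n<1+n i) i+1<d) = dualDegree-suc G (suc i)
  ... | no  i+1≮d rewrite <ᵇ-false (ℕ.≮⇒≥ i+1≮d) = ℕ.z≤n

  chain-dualDegreePoint : ∀ {d} {x : Point d} (G : SimpleGraph (suc d)) → (∀ j → x j ≡ ℕ→ℚ (dualDegree G (suc (toℕ j)))) →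
                          ∀ i → chain (ℕ→ℚ (suc d)) x i ≡ ℕ→ℚ (dualChain G i)
  chain-dualDegreePoint     G x≡d* zero    = refl
  chain-dualDegreePoint {d} G x≡d* (suc i) =
    trans (extend-cong x≡d* i) (trans (extend-tabulate {d} (λ t → ℕ→ℚ (dualDegree G (suc t))) i)
                                      (sym (ℕ→ℚ-if (i <ᵇ d) (dualDegree G (suc i)))))

  dualDegreePoint-slack-nonneg : ∀ {d} {x : Point d} → DualDegreePoint (suc d) x → ∀ k → 0ℚ ≤ slack (ℕ→ℚ (suc d)) x k
  dualDegreePoint-slack-nonneg (G , x≡d*) k =
    subst₂ (λ p q → 0ℚ ≤ p - q) (sym (chain-dualDegreePoint G x≡d* (toℕ k))) (sym (chain-dualDegreePoint G x≡d* (suc (toℕ k))))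
           (p≤q⇒0≤q-p (ℕ→ℚ-mono-≤ (dualChain-antitone G (toℕ k))))

  regular⇒vertex∈dualDegreePoints : ∀ {n} (G : SimpleGraph n) k → (∀ i → degree G i ≡ toℕ k) → DualDegreePoint n (a n k)
  regular⇒vertex∈dualDegreePoints {n} G k regular = G , λ j →
    trans (sym (ℕ→ℚ-if (toℕ j <ᵇ toℕ k) n)) (cong ℕ→ℚ (sym (dualDegree-regular G (toℕ k) regular (toℕ j))))

  vertex∈dualDegreePoints : ∀ {n} → 2 ∣ n → ∀ k → DualDegreePoint n (a n k)
  vertex∈dualDegreePoints 2∣n k = regular⇒vertex∈dualDegreePoints (proj₁ k-regular) k (proj₂ k-regular)
    where k-regular = regular-graph 2∣n (toℕ k) (toℕ<n k)

open SlackCoordinates using (slack)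

module Simplex (d : ℕ) (S : PSet d)
  (S-slack-nonneg : ∀ {x} → S x → ∀ k → ℚ.0ℚ ℚ.≤ slack (ℕ→ℚ (suc d)) x k)
  (S-vertices : ∀ k → S (a (suc d) k)) where

  open import Data.Fin using (Fin; zero; suc; _≟_)
  open import Data.Fin.Properties using (any?)
  open import Data.List using ([]; _∷_; map; allFin)
  open import Data.List.Relation.Unary.All using (All; []; _∷_)
  open import Data.Nat as ℕ using (ℕ; zero; suc)
  open import Data.Product using (Σ; ∃; _×_; _,_; proj₁; proj₂; map₂)
  open import Data.Rational using (ℚ; 0ℚ; 1ℚ; _+_; _*_; _-_; _≤_; _<_; 1/_; NonZero; ≢-nonZero)
  open import Data.Rational.Properties renaming (_≟_ to _≟ℚ_)
  open import Data.Rational.Solver using (module +-*-Solver)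
  open import Data.Sum using (_⊎_; inj₁; inj₂)
  open import Function using (_∘_; id)
  open import Relation.Binary.PropositionalEquality
  open import Relation.Nullary using (Dec; ¬_; ¬?; yes; no; contradiction)
  open import Relation.Nullary.Decidable using (decidable-stable)
  open Arithmetic
  open Geometry
  open LinearAlgebra using (underdetermined-solution)
  open SlackCoordinates
  open +-*-Solver

  n : ℕ
  n = suc d

  nℚ : ℚ
  nℚ = ℕ→ℚ n

  P : PSet d
  P = ConvexHull S

  nℚ≢0 : nℚ ≢ 0ℚ
  nℚ≢0 = pos⇒≢0 (ℕ→ℚ-pos d)

  instance
    nℚ-nonZero : NonZero nℚ
    nℚ-nonZero = ≢-nonZero nℚ≢0

  barycentre : (Fin n → ℚ) → Point d
  barycentre w j = ∑[ k < n ] (w k * a n k j)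

  barycentric : Point d → Fin n → ℚ
  barycentric x k = slack nℚ x k * 1/ nℚ

  ∑-barycentric : ∀ x → ∑[ k < n ] barycentric x k ≡ 1ℚ
  ∑-barycentric x = begin
    ∑[ k < n ] (slack nℚ x k * 1/ nℚ) ≡⟨ *-distribʳ-sum (1/ nℚ) (slack nℚ x) ⟨
    ∑[ k < n ] slack nℚ x k * 1/ nℚ   ≡⟨ cong (_* 1/ nℚ) (∑-slack nℚ x) ⟩
    nℚ * 1/ nℚ                         ≡⟨ *-inverseʳ nℚ ⟩
    1ℚ                                 ∎
    where open ≡-Reasoning

  slack-barycentre : ∀ w → ∑[ k < n ] w k ≡ 1ℚ → slack nℚ (barycentre w) ≈ₚ λ k → w k * nℚ
  slack-barycentre w ∑w≡1 k = begin
    slack nℚ (barycentre w) k                  ≡⟨ cong (λ t → slack t (barycentre w) k) nℚ≡∑wn ⟩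
    slack (∑[ i < n ] (w i * nℚ)) (barycentre w) k ≡⟨ slack-∑ nℚ w (a n) k ⟩
    ∑[ i < n ] (w i * slack nℚ (a n i) k)
      ≡⟨ ∑-single _ k (λ i i≢k → trans (cong (w i *_) (slack-a-≢ i k (i≢k ∘ sym))) (*-zeroʳ (w i))) ⟩
    w k * slack nℚ (a n k) k                   ≡⟨ cong (w k *_) (slack-a-≡ k) ⟩
    w k * nℚ                                   ∎
    where
    open ≡-Reasoning
    nℚ≡∑wn : nℚ ≡ ∑[ i < n ] (w i * nℚ)
    nℚ≡∑wn = trans (sym (*-identityˡ nℚ)) (trans (cong (_* nℚ) (sym ∑w≡1)) (*-distribʳ-sum nℚ w))

  barycentric-barycentre : ∀ w → ∑[ k < n ] w k ≡ 1ℚ → barycentric (barycentre w) ≈ₚ w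
  barycentric-barycentre w ∑w≡1 k = begin
    slack nℚ (barycentre w) k * 1/ nℚ ≡⟨ cong (_* 1/ nℚ) (slack-barycentre w ∑w≡1 k) ⟩
    w k * nℚ * 1/ nℚ                  ≡⟨ *-assoc (w k) nℚ (1/ nℚ) ⟩
    w k * (nℚ * 1/ nℚ)                ≡⟨ cong (w k *_) (*-inverseʳ nℚ) ⟩
    w k * 1ℚ                          ≡⟨ *-identityʳ (w k) ⟩
    w k                               ∎
    where open ≡-Reasoning

  barycentric*nℚ : ∀ x k → barycentric x k * nℚ ≡ slack nℚ x k
  barycentric*nℚ x k = begin
    slack nℚ x k * 1/ nℚ * nℚ   ≡⟨ *-assoc (slack nℚ x k) (1/ nℚ) nℚ ⟩
    slack nℚ x k * (1/ nℚ * nℚ) ≡⟨ cong (slack nℚ x k *_) (*-inverseˡ nℚ) ⟩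
    slack nℚ x k * 1ℚ           ≡⟨ *-identityʳ (slack nℚ x k) ⟩
    slack nℚ x k                ∎
    where open ≡-Reasoning

  barycentric-injective : ∀ {x y} → barycentric x ≈ₚ barycentric y → x ≈ₚ y
  barycentric-injective {x} {y} same = slack-injective nℚ nℚ λ k →
    trans (sym (barycentric*nℚ x k)) (trans (cong (_* nℚ) (same k)) (barycentric*nℚ y k))

  barycentre-barycentric : ∀ x → x ≈ₚ barycentre (barycentric x)
  barycentre-barycentric x = barycentric-injective (λ k → sym (barycentric-barycentre (barycentric x) (∑-barycentric x) k))

  a∈P : ∀ k → P (a n k)
  a∈P k = ((1ℚ , a n k) ∷ []) , ((<⇒≤ (ℕ→ℚ-pos 0) , S-vertices k) ∷ []) , refl , λ j → sym (a≡1*a+0 j)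
    where
    a≡1*a+0 : ∀ j → 1ℚ * a n k j + 0ℚ ≡ a n k j
    a≡1*a+0 j = solve 1 (λ x → con 1ℚ :* x :+ con 0ℚ := x) refl (a n k j)

  barycentre∈P : ∀ w → (∀ k → 0ℚ ≤ w k) → ∑[ k < n ] w k ≡ 1ℚ → P (barycentre w)
  barycentre∈P w w≥0 ∑w≡1 =
    map (λ k → w k , a n k) (allFin n) ,
    All.map⁺ (All.tabulate⁺ (λ k → w≥0 k , S-vertices k)) ,
    trans (coeffSum-map w (a n) (allFin n)) (trans (sumℚ-allFin w) ∑w≡1) ,
    λ j → sym (trans (combo-map w (a n) (allFin n) j) (sumℚ-allFin (λ k → w k * a n k j)))
    where import Data.List.Relation.Unary.All.Properties as All

  P-slack-nonneg : ∀ {x} → P x → ∀ k → 0ℚ ≤ slack nℚ x k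
  P-slack-nonneg {x} (ps , ps∈S , ∑ps≡1 , x≈ps) k = subst (0ℚ ≤_) (sym slack≡combo) (combo-nonneg ps ps∈S)
    where
    slack≡combo : slack nℚ x k ≡ combo (map (map₂ (slack nℚ)) ps) k
    slack≡combo = begin
      slack nℚ x k                 ≡⟨ slack-cong nℚ x≈ps k ⟩
      slack nℚ (combo ps) k        ≡⟨ cong (λ t → slack t (combo ps) k) (trans (sym (*-identityˡ nℚ)) (cong (_* nℚ) (sym ∑ps≡1))) ⟩
      slack (coeffSum ps * nℚ) (combo ps) k ≡⟨ slack-combo nℚ ps k ⟩
      combo (map (map₂ (slack nℚ)) ps) k ∎
      where open ≡-Reasoning
    combo-nonneg : ∀ qs → All (λ lp → (0ℚ ≤ proj₁ lp) × S (proj₂ lp)) qs → 0ℚ ≤ combo (map (map₂ (slack nℚ)) qs) k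
    combo-nonneg []             []                  = ≤-refl
    combo-nonneg ((l , p) ∷ qs) ((l≥0 , p∈S) ∷ qs∈S) =
      +-mono-≤ (*-nonneg l≥0 (S-slack-nonneg p∈S k)) (combo-nonneg qs qs∈S)

  barycentric-nonneg : ∀ {x} → P x → ∀ k → 0ℚ ≤ barycentric x k
  barycentric-nonneg x∈P k = *-nonneg (P-slack-nonneg x∈P k) (<⇒≤ (1/-pos (ℕ→ℚ-pos d)))

  slack-convex₂ : ∀ {x y z : Point d} t → (∀ j → x j ≡ t * y j + (1ℚ - t) * z j) →
                  ∀ k → slack nℚ x k ≡ t * slack nℚ y k + (1ℚ - t) * slack nℚ z k
  slack-convex₂ {x} {y} {z} t x≡ty+uz k = begin
    slack nℚ x k                           ≡⟨ slack-cong nℚ (λ j → trans (x≡ty+uz j) (cong (t * y j +_) (sym (+-identityʳ _)))) k ⟩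
    slack nℚ (combo yz) k
      ≡⟨ cong (λ s → slack s (combo yz) k) (solve 2 (λ t n → n := (t :+ ((con 1ℚ :- t) :+ con 0ℚ)) :* n) refl t nℚ) ⟩
    slack (coeffSum yz * nℚ) (combo yz) k  ≡⟨ slack-combo nℚ yz k ⟩
    t * slack nℚ y k + ((1ℚ - t) * slack nℚ z k + 0ℚ) ≡⟨ cong (t * slack nℚ y k +_) (+-identityʳ _) ⟩
    t * slack nℚ y k + (1ℚ - t) * slack nℚ z k ∎
    where
    open ≡-Reasoning
    yz = (t , y) ∷ (1ℚ - t , z) ∷ []

  barycentric-convex₂ : ∀ {x y z : Point d} t → (∀ j → x j ≡ t * y j + (1ℚ - t) * z j) →
                    ∀ k → barycentric x k ≡ t * barycentric y k + (1ℚ - t) * barycentric z k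
  barycentric-convex₂ {y = y} {z} t x≡ty+uz k =
    trans (cong (_* 1/ nℚ) (slack-convex₂ t x≡ty+uz k))
          (solve 4 (λ t a b i → (t :* a :+ (con 1ℚ :- t) :* b) :* i := t :* (a :* i) :+ (con 1ℚ :- t) :* (b :* i))
                 refl t (slack nℚ y k) (slack nℚ z k) (1/ nℚ))

  barycentric-a-≡ : ∀ k → barycentric (a n k) k ≡ 1ℚ
  barycentric-a-≡ k = trans (cong (_* 1/ nℚ) (slack-a-≡ k)) (*-inverseʳ nℚ)

  barycentric-a-≢ : ∀ k m → m ≢ k → barycentric (a n k) m ≡ 0ℚ
  barycentric-a-≢ k m m≢k = trans (cong (_* 1/ nℚ) (slack-a-≢ k m m≢k)) (*-zeroˡ (1/ nℚ))

  barycentric-supported⇒vertex : ∀ {x} k → (∀ m → m ≢ k → barycentric x m ≡ 0ℚ) → x ≈ₚ a n k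
  barycentric-supported⇒vertex {x} k w≡0 j = begin
    x j                                     ≡⟨ barycentre-barycentric x j ⟩
    ∑[ m < n ] (barycentric x m * a n m j)      ≡⟨ ∑-single _ k (λ m m≢k → trans (cong (_* a n m j) (w≡0 m m≢k)) (*-zeroˡ (a n m j))) ⟩
    barycentric x k * a n k j                   ≡⟨ cong (_* a n k j) wₖ≡1 ⟩
    1ℚ * a n k j                            ≡⟨ *-identityˡ (a n k j) ⟩
    a n k j                                 ∎
    where
    open ≡-Reasoning
    wₖ≡1 : barycentric x k ≡ 1ℚ
    wₖ≡1 = trans (sym (∑-single (barycentric x) k w≡0)) (∑-barycentric x)

  vertex-extreme : ∀ k → ExtremePoint P (a n k)
  vertex-extreme k = a∈P k , λ y z t y∈P z∈P t>0 t<1 a≡ty+sz j →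
    trans (on-vertex y∈P z∈P t>0 (p<q⇒0<q-p t<1) a≡ty+sz j)
          (sym (on-vertex z∈P y∈P (p<q⇒0<q-p t<1) (subst (0ℚ <_) (1-[1-t]≡t t) t>0)
                          (λ j → trans (a≡ty+sz j) (swap t (y j) (z j))) j))
    where
    1-[1-t]≡t : ∀ t → t ≡ 1ℚ - (1ℚ - t)
    1-[1-t]≡t = solve 1 (λ t → t := con 1ℚ :- (con 1ℚ :- t)) refl
    swap : ∀ t y z → t * y + (1ℚ - t) * z ≡ (1ℚ - t) * z + (1ℚ - (1ℚ - t)) * y
    swap = solve 3 (λ t y z → t :* y :+ (con 1ℚ :- t) :* z := (con 1ℚ :- t) :* z :+ (con 1ℚ :- (con 1ℚ :- t)) :* y) refl
    on-vertex : ∀ {y z t} → P y → P z → 0ℚ < t → 0ℚ < 1ℚ - t → (∀ j → a n k j ≡ t * y j + (1ℚ - t) * z j) → y ≈ₚ a n k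
    on-vertex {y} {z} {t} y∈P z∈P t>0 s>0 a≡ty+sz = barycentric-supported⇒vertex k λ m m≢k →
      pos*p+pos*q≡0⇒p≡0 t>0 s>0 (barycentric-nonneg y∈P m) (barycentric-nonneg z∈P m)
        (trans (sym (barycentric-convex₂ t a≡ty+sz m)) (barycentric-a-≢ k m m≢k))

  -- With t = barycentric x k < 1, x = t·a⁽ᵏ⁾ + (1 − t)·barycentre ν, where ν drops the k-th barycentric
  -- coordinate of x and rescales the others by 1/(1 − t).
  module SplitOffVertex {x : Point d} (x∈P : P x) (k : Fin n) (t<1 : barycentric x k < 1ℚ) where

    t : ℚ
    t = barycentric x k

    w u : Fin n → ℚ
    w = barycentric x
    u = barycentric (a n k)

    s>0 : 0ℚ < 1ℚ - t
    s>0 = p<q⇒0<q-p t<1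

    instance
      s-nonZero : NonZero (1ℚ - t)
      s-nonZero = ≢-nonZero (pos⇒≢0 s>0)

    c : ℚ
    c = 1/ (1ℚ - t)

    s*c≡1 : (1ℚ - t) * c ≡ 1ℚ
    s*c≡1 = *-inverseʳ (1ℚ - t)

    ν : Fin n → ℚ
    ν m = (w m - t * u m) * c

    νₖ≡0 : ν k ≡ 0ℚ
    νₖ≡0 = begin
      (t - t * u k) * c   ≡⟨ cong (λ v → (t - t * v) * c) (barycentric-a-≡ k) ⟩
      (t - t * 1ℚ) * c    ≡⟨ cong (λ v → (t - v) * c) (*-identityʳ t) ⟩
      (t - t) * c         ≡⟨ cong (_* c) (+-inverseʳ t) ⟩
      0ℚ * c              ≡⟨ *-zeroˡ c ⟩
      0ℚ                  ∎
      where open ≡-Reasoning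

    νₘ≡wₘ*c : ∀ m → m ≢ k → ν m ≡ w m * c
    νₘ≡wₘ*c m m≢k = begin
      (w m - t * u m) * c  ≡⟨ cong (λ v → (w m - t * v) * c) (barycentric-a-≢ k m m≢k) ⟩
      (w m - t * 0ℚ) * c   ≡⟨ cong (λ v → (w m - v) * c) (*-zeroʳ t) ⟩
      (w m - 0ℚ) * c       ≡⟨ cong (_* c) (+-identityʳ (w m)) ⟩
      w m * c              ∎
      where open ≡-Reasoning

    ν≥0 : ∀ m → 0ℚ ≤ ν m
    ν≥0 m = by-cases (m ≟ k)
      where
      by-cases : Dec (m ≡ k) → 0ℚ ≤ ν m
      by-cases (yes refl) = ≤-reflexive (sym νₖ≡0)
      by-cases (no  m≢k)  = subst (0ℚ ≤_) (sym (νₘ≡wₘ*c m m≢k)) (*-nonneg (barycentric-nonneg x∈P m) (<⇒≤ (1/-pos s>0)))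

    ∑ν≡1 : ∑[ m < n ] ν m ≡ 1ℚ
    ∑ν≡1 = begin
      ∑[ m < n ] ((w m - t * u m) * c)              ≡⟨ *-distribʳ-sum c (λ m → w m - t * u m) ⟨
      ∑[ m < n ] (w m - t * u m) * c                ≡⟨ cong (_* c) (∑-distrib-− w (λ m → t * u m)) ⟩
      (∑[ m < n ] w m - ∑[ m < n ] (t * u m)) * c   ≡⟨ cong (λ v → (∑[ m < n ] w m - v) * c) (*-distribˡ-sum t u) ⟨
      (∑[ m < n ] w m - t * ∑[ m < n ] u m) * c     ≡⟨ cong₂ (λ p q → (p - t * q) * c) (∑-barycentric x) (∑-barycentric (a n k)) ⟩
      (1ℚ - t * 1ℚ) * c                            ≡⟨ cong (λ v → (1ℚ - v) * c) (*-identityʳ t) ⟩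
      (1ℚ - t) * c                                 ≡⟨ s*c≡1 ⟩
      1ℚ                                           ∎
      where open ≡-Reasoning

    x≡ta+sz : ∀ j → x j ≡ t * a n k j + (1ℚ - t) * barycentre ν j
    x≡ta+sz = barycentric-injective λ m → sym (begin
      barycentric (λ j → t * a n k j + (1ℚ - t) * barycentre ν j) m ≡⟨ barycentric-convex₂ t (λ j → refl) m ⟩
      t * u m + (1ℚ - t) * barycentric (barycentre ν) m
        ≡⟨ cong (λ v → t * u m + (1ℚ - t) * v) (barycentric-barycentre ν ∑ν≡1 m) ⟩
      t * u m + (1ℚ - t) * ((w m - t * u m) * c)
        ≡⟨ solve 5 (λ t u s w c → t :* u :+ s :* ((w :- t :* u) :* c) := t :* u :+ (s :* c) :* (w :- t :* u)) refl t (u m) (1ℚ - t) (w m) c ⟩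
      t * u m + ((1ℚ - t) * c) * (w m - t * u m)              ≡⟨ cong (λ v → t * u m + v * (w m - t * u m)) s*c≡1 ⟩
      t * u m + 1ℚ * (w m - t * u m)
        ≡⟨ solve 3 (λ t u w → t :* u :+ con 1ℚ :* (w :- t :* u) := w) refl t (u m) (w m) ⟩
      w m                                                     ∎)
      where open ≡-Reasoning

  split-off-vertex : ∀ {x} → P x → ∀ k → barycentric x k < 1ℚ →
                     Σ (Point d) λ z → P z × (∀ j → x j ≡ barycentric x k * a n k j + (1ℚ - barycentric x k) * z j)
  split-off-vertex x∈P k t<1 = barycentre ν , barycentre∈P ν ν≥0 ∑ν≡1 , x≡ta+sz
    where open SplitOffVertex x∈P k t<1

  extreme∧barycentric<1⇒vertex : ∀ {x} → ExtremePoint P x → ∀ k → 0ℚ < barycentric x k → barycentric x k < 1ℚ → x ≈ₚ a n k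
  extreme∧barycentric<1⇒vertex {x} (x∈P , extreme) k t>0 t<1 = conclude (split-off-vertex x∈P k t<1)
    where
    t = barycentric x k
    conclude : (Σ (Point d) λ z → P z × (∀ j → x j ≡ t * a n k j + (1ℚ - t) * z j)) → x ≈ₚ a n k
    conclude (z , z∈P , x≡ta+sz) j = begin
      x j                                 ≡⟨ x≡ta+sz j ⟩
      t * a n k j + (1ℚ - t) * z j        ≡⟨ cong (λ v → t * a n k j + (1ℚ - t) * v) (a≈z j) ⟨
      t * a n k j + (1ℚ - t) * a n k j    ≡⟨ solve 2 (λ t v → t :* v :+ (con 1ℚ :- t) :* v := v) refl t (a n k j) ⟩
      a n k j                             ∎
      where
      open ≡-Reasoning
      a≈z : a n k ≈ₚ z
      a≈z = extreme (a n k) z t (a∈P k) z∈P t>0 t<1 x≡ta+sz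

  extreme∧barycentric≢0⇒vertex : ∀ {x} → ExtremePoint P x → ∀ k → barycentric x k ≢ 0ℚ → x ≈ₚ a n k
  extreme∧barycentric≢0⇒vertex {x} x-extreme@(x∈P , _) k wₖ≢0 = by-cases (barycentric x k ≟ℚ 1ℚ)
    where
    wₖ≥0 = barycentric-nonneg x∈P k
    by-cases : Dec (barycentric x k ≡ 1ℚ) → x ≈ₚ a n k
    by-cases (yes wₖ≡1) = barycentric-supported⇒vertex k
      (∑-nonneg≡term⇒others≡0 (barycentric-nonneg x∈P) k (trans (∑-barycentric x) (sym wₖ≡1)))
    by-cases (no wₖ≢1)  = extreme∧barycentric<1⇒vertex x-extreme k (≤∧≢⇒< wₖ≥0 (≢-sym wₖ≢0))
      (≤∧≢⇒< (≤-trans (term≤∑-nonneg (barycentric-nonneg x∈P) k) (≤-reflexive (∑-barycentric x))) wₖ≢1)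

  extreme⇒vertex : ∀ {x} → ExtremePoint P x → ∃ λ k → x ≈ₚ a n k
  extreme⇒vertex {x} x-extreme = by-cases (any? (λ k → ¬? (barycentric x k ≟ℚ 0ℚ)))
    where
    by-cases : Dec (∃ λ k → barycentric x k ≢ 0ℚ) → ∃ λ k → x ≈ₚ a n k
    by-cases (yes (k , wₖ≢0)) = k , extreme∧barycentric≢0⇒vertex x-extreme k wₖ≢0
    by-cases (no  no-weight)  = contradiction (trans (sym (∑-barycentric x)) (trans (sum-cong-≗ wₖ≡0) (sum-replicate-zero n))) λ ()
      where
      wₖ≡0 : ∀ k → barycentric x k ≡ 0ℚ
      wₖ≡0 k = decidable-stable (barycentric x k ≟ℚ 0ℚ) (λ wₖ≢0 → no-weight (k , wₖ≢0))

  vertices-affinelyIndependent : ∀ {m} (π : Fin m → Fin n) → (∀ {i i′} → π i ≡ π i′ → i ≡ i′) →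
                                 AffinelyIndependent (a n ∘ π)
  vertices-affinelyIndependent {suc m} π π-injective l ∑la≡0 ∑l≡0 i =
    p*q≡0⇒q≡0 nℚ≢0 (trans (*-comm nℚ (l i)) (trans (sym slackᵢ≡lᵢn) slackᵢ≡0))
    where
    y = λ j → ∑[ i′ < suc m ] (l i′ * a n (π i′) j)
    top = ∑[ i′ < suc m ] (l i′ * nℚ)
    slackᵢ≡lᵢn : slack top y (π i) ≡ l i * nℚ
    slackᵢ≡lᵢn = trans (slack-∑ nℚ l (a n ∘ π) (π i))
      (trans (∑-single _ i (λ i′ i′≢i → trans (cong (l i′ *_) (slack-a-≢ (π i′) (π i) (i′≢i ∘ π-injective ∘ sym)))
                                              (*-zeroʳ (l i′))))
             (cong (l i *_) (slack-a-≡ (π i))))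
    top≡0 : top ≡ 0ℚ
    top≡0 = trans (sym (*-distribʳ-sum nℚ l)) (trans (cong (_* nℚ) (trans (sym (sumℚ-allFin l)) ∑l≡0)) (*-zeroˡ nℚ))
    slackᵢ≡0 : slack top y (π i) ≡ 0ℚ
    slackᵢ≡0 = trans (cong (λ t → slack t y (π i)) top≡0)
                     (trans (slack-cong 0ℚ (λ j → trans (sym (sumℚ-allFin (λ i′ → l i′ * a n (π i′) j))) (∑la≡0 j)) (π i))
                            (slack-zero (π i)))

  supported-¬affinelyIndependent :
    ∀ {K} (p : Fin (suc K) → Point d) (ι : Fin K → Fin n) →
    (∀ m → (∃ λ c → ι c ≡ m) ⊎ (∀ i → slack nℚ (p i) m ≡ 0ℚ)) → ¬ AffinelyIndependent p
  supported-¬affinelyIndependent {K} p ι supported indep = lᵢ≢0 (indep l ∑lp≡0 ∑l≡0 i)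
    where
    solution = underdetermined-solution K (λ c i → slack nℚ (p i) (ι c))
    l = proj₁ solution
    i = proj₁ (proj₁ (proj₂ solution))
    lᵢ≢0 = proj₂ (proj₁ (proj₂ solution))
    y = λ j → ∑[ i < suc K ] (l i * p i j)
    top = ∑[ i < suc K ] (l i * nℚ)
    slack-y≡0 : ∀ m → slack top y m ≡ 0ℚ
    slack-y≡0 m = trans (slack-∑ nℚ l p m) (by-cases (supported m))
      where
      by-cases : (∃ λ c → ι c ≡ m) ⊎ (∀ i → slack nℚ (p i) m ≡ 0ℚ) → ∑[ i < suc K ] (l i * slack nℚ (p i) m) ≡ 0ℚ
      by-cases (inj₁ (c , refl)) = trans (sum-cong-≗ (λ i → *-comm (l i) (slack nℚ (p i) (ι c)))) (proj₂ (proj₂ solution) c)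
      by-cases (inj₂ slack≡0)    = trans (sum-cong-≗ (λ i → trans (cong (l i *_) (slack≡0 i)) (*-zeroʳ (l i))))
                                         (sum-replicate-zero (suc K))
    top≡0 : top ≡ 0ℚ
    top≡0 = trans (sym (∑-slack top y)) (trans (sum-cong-≗ slack-y≡0) (sum-replicate-zero n))
    ∑l≡0 : sumℚ (map l (allFin (suc K))) ≡ 0ℚ
    ∑l≡0 = trans (sumℚ-allFin l) (p*q≡0⇒q≡0 nℚ≢0 (trans (*-comm nℚ _) (trans (*-distribʳ-sum nℚ l) top≡0)))
    ∑lp≡0 : ∀ j → sumℚ (map (λ i → l i * p i j) (allFin (suc K))) ≡ 0ℚ
    ∑lp≡0 j = trans (sumℚ-allFin (λ i → l i * p i j)) (slack-injective top 0ℚ (λ m → trans (slack-y≡0 m) (sym (slack-zero m))) j)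

  P-dimension : HasDim P d
  P-dimension = (a n , a∈P , vertices-affinelyIndependent id id) ,
                λ (p , _ , indep) → supported-¬affinelyIndependent p id (λ m → inj₁ (m , refl)) indep

module Facets (e : ℕ) (S : PSet (suc e))
  (S-slack-nonneg : ∀ {x} → S x → ∀ k → ℚ.0ℚ ℚ.≤ slack (ℕ→ℚ (suc (suc e))) x k)
  (S-vertices : ∀ k → S (a (suc (suc e)) k)) where

  open import Data.Fin using (Fin; zero; suc; _≟_; punchIn; punchOut)
  open import Data.Fin.Properties using (any?; punchIn-punchOut; punchIn-injective; punchInᵢ≢i)
  open import Data.Nat using (ℕ; zero; suc)
  import Data.Nat.Properties as ℕ
  open import Data.Product using (Σ; ∃; _×_; _,_; proj₁; proj₂)
  open import Data.Rational using (ℚ; 0ℚ; 1ℚ; _*_; _-_; _≤_; _<_; 1/_)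
  open import Data.Rational.Properties renaming (_≟_ to _≟ℚ_)
  open import Data.Rational.Solver using (module +-*-Solver)
  open import Data.Sum using (_⊎_; inj₁; inj₂)
  open import Function using (_∘_)
  open import Relation.Binary.PropositionalEquality
  open import Relation.Nullary using (Dec; ¬_; ¬?; yes; no; contradiction)
  open import Relation.Nullary.Decidable using (decidable-stable; _×-dec_)
  open Arithmetic
  open Geometry
  open Simplex (suc e) S S-slack-nonneg S-vertices public
  open SlackCoordinates
  open +-*-Solver

  ScaledIneq : Point (suc e) → ℚ → Set
  ScaledIneq c b = Σ (Fin n) λ k → Σ ℚ λ r → (0ℚ < r) × ((∀ j → c j ≡ r * ineqCoeff n k j) × (b ≡ r * ineqBound n k))

  dot-scaledIneq : ∀ {c b} k r → (∀ j → c j ≡ r * ineqCoeff n k j) → b ≡ r * ineqBound n k →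
                   ∀ x → dot c x ≡ b - r * slack nℚ x k
  dot-scaledIneq {c} {b} k r c≡ b≡ x = begin
    dot c x                                    ≡⟨ dot-cong c≡ (λ _ → refl) ⟩
    dot (λ j → r * ineqCoeff n k j) x          ≡⟨ dot-*ˡ r (ineqCoeff n k) x ⟩
    r * dot (ineqCoeff n k) x                  ≡⟨ cong (r *_) (dot-ineqCoeff k x) ⟩
    r * (ineqBound n k - slack nℚ x k)
      ≡⟨ solve 3 (λ r b s → r :* (b :- s) := r :* b :- r :* s) refl r (ineqBound n k) (slack nℚ x k) ⟩
    r * ineqBound n k - r * slack nℚ x k       ≡⟨ cong (_- r * slack nℚ x k) b≡ ⟨
    b - r * slack nℚ x k                       ∎
    where open ≡-Reasoning

  punchIn-cover : ∀ {m} (k j : Fin (suc m)) → (∃ λ c → punchIn k c ≡ j) ⊎ j ≡ k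
  punchIn-cover k j with j ≟ k
  ... | yes j≡k = inj₂ j≡k
  ... | no  j≢k = inj₁ (punchOut (j≢k ∘ sym) , punchIn-punchOut (j≢k ∘ sym))

  scaledIneq⇒facet : ∀ c b → ScaledIneq c b → FacetDefining P c b
  scaledIneq⇒facet c b (k , r , r>0 , c≡ , b≡) = valid , e , P-dimension , face-indep , face-¬indep
    where
    dot≡ = dot-scaledIneq k r c≡ b≡
    valid : ValidIneq P c b
    valid x x∈P = subst (_≤ b) (sym (dot≡ x)) (0≤q⇒p-q≤p (*-nonneg (<⇒≤ r>0) (P-slack-nonneg x∈P k)))
    face-indep : HasAffIndep (FaceOf P c b) e
    face-indep = a n ∘ punchIn k , (λ i → a∈P (punchIn k i) , on-face i) ,
                 vertices-affinelyIndependent (punchIn k) (punchIn-injective k _ _)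
      where
      on-face : ∀ i → dot c (a n (punchIn k i)) ≡ b
      on-face i = trans (dot≡ _) (trans (cong (λ s → b - r * s) (slack-a-≢ (punchIn k i) k (punchInᵢ≢i k i ∘ sym)))
                                        (solve 2 (λ b r → b :- r :* con 0ℚ := b) refl b r))
    face-¬indep : ¬ HasAffIndep (FaceOf P c b) (suc e)
    face-¬indep (p , p∈F , indep) = supported-¬affinelyIndependent p (punchIn k) supported indep
      where
      slackₖ≡0 : ∀ i → slack nℚ (p i) k ≡ 0ℚ
      slackₖ≡0 i = p*q≡0⇒q≡0 (pos⇒≢0 r>0) (b-p≡b⇒p≡0 b _ (trans (sym (dot≡ (p i))) (proj₂ (p∈F i))))
      supported : ∀ m → (∃ λ c → punchIn k c ≡ m) ⊎ (∀ i → slack nℚ (p i) m ≡ 0ℚ)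
      supported m with punchIn-cover k m
      ... | inj₁ covered = inj₁ covered
      ... | inj₂ refl    = inj₂ slackₖ≡0

  module ValidInequality (c : Point (suc e)) (b : ℚ) (valid : ValidIneq P c b) where

    gap : Fin n → ℚ
    gap m = b - dot c (a n m)

    gap≥0 : ∀ m → 0ℚ ≤ gap m
    gap≥0 m = p≤q⇒0≤q-p (valid (a n m) (a∈P m))

    dot-barycentric : ∀ x → dot c x ≡ b - ∑[ m < n ] (barycentric x m * gap m)
    dot-barycentric x = begin
      dot c x                                              ≡⟨ dot-cong {c = c} (λ _ → refl) (barycentre-barycentric x) ⟩
      dot c (barycentre w)                                 ≡⟨ dot-∑ʳ c w (a n) ⟩
      ∑[ m < n ] (w m * dot c (a n m))
        ≡⟨ sum-cong-≗ (λ m → solve 3 (λ w b t → w :* t := w :* b :- w :* (b :- t)) refl (w m) b (dot c (a n m))) ⟩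
      ∑[ m < n ] (w m * b - w m * gap m)                     ≡⟨ ∑-distrib-− (λ m → w m * b) (λ m → w m * gap m) ⟩
      ∑[ m < n ] (w m * b) - ∑[ m < n ] (w m * gap m)        ≡⟨ cong (_- ∑[ m < n ] (w m * gap m)) (*-distribʳ-sum b w) ⟨
      ∑[ m < n ] w m * b - ∑[ m < n ] (w m * gap m)          ≡⟨ cong (λ v → v * b - ∑[ m < n ] (w m * gap m)) (∑-barycentric x) ⟩
      1ℚ * b - ∑[ m < n ] (w m * gap m)                      ≡⟨ cong (_- ∑[ m < n ] (w m * gap m)) (*-identityˡ b) ⟩
      b - ∑[ m < n ] (w m * gap m)                           ∎
      where
      open ≡-Reasoning
      w = barycentric x

    face-slack≡0 : ∀ {x} → FaceOf P c b x → ∀ m → gap m ≢ 0ℚ → slack nℚ x m ≡ 0ℚ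
    face-slack≡0 {x} (x∈P , on-face) m gapₘ≢0 = trans (sym (barycentric*nℚ x m)) (trans (cong (_* nℚ) wₘ≡0) (*-zeroˡ nℚ))
      where
      ∑wgap≡0 : ∑[ m < n ] (barycentric x m * gap m) ≡ 0ℚ
      ∑wgap≡0 = b-p≡b⇒p≡0 b _ (trans (sym (dot-barycentric x)) on-face)
      wₘ≡0 : barycentric x m ≡ 0ℚ
      wₘ≡0 = p*q≡0⇒q≡0 gapₘ≢0 (trans (*-comm (gap m) (barycentric x m))
               (∑-nonneg≡0⇒≡0 (λ m → *-nonneg (barycentric-nonneg x∈P m) (gap≥0 m)) ∑wgap≡0 m))

    no-gap⇒P⊆face : (∀ m → gap m ≡ 0ℚ) → ∀ {x} → P x → FaceOf P c b x
    no-gap⇒P⊆face gap≡0 {x} x∈P = x∈P , trans (dot-barycentric x)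
      (trans (cong (λ q → b - q) (trans (sum-cong-≗ (λ m → trans (cong (barycentric x m *_) (gap≡0 m)) (*-zeroʳ (barycentric x m))))
                                        (sum-replicate-zero n)))
             (solve 1 (λ b → b :- con 0ℚ := b) refl b))

    two-gaps⇒¬face-indep : ∀ m₀ m → m ≢ m₀ → gap m₀ ≢ 0ℚ → gap m ≢ 0ℚ → ¬ HasAffIndep (FaceOf P c b) e
    two-gaps⇒¬face-indep m₀ m m≢m₀ gapₘ₀≢0 gapₘ≢0 (p , p∈F , indep) = supported-¬affinelyIndependent p ι supported indep
      where
      m′ = punchOut (m≢m₀ ∘ sym)
      ι = punchIn m₀ ∘ punchIn m′
      supported : ∀ j → (∃ λ c → ι c ≡ j) ⊎ (∀ i → slack nℚ (p i) j ≡ 0ℚ)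
      supported j with punchIn-cover m₀ j
      ... | inj₂ refl = inj₂ (λ i → face-slack≡0 (p∈F i) m₀ gapₘ₀≢0)
      ... | inj₁ (j′ , refl) with punchIn-cover m′ j′
      ...   | inj₁ (j″ , refl) = inj₁ (j″ , refl)
      ...   | inj₂ refl        = inj₂ (λ i → subst (λ j → slack nℚ (p i) j ≡ 0ℚ) (sym (punchIn-punchOut (m≢m₀ ∘ sym)))
                                                    (face-slack≡0 (p∈F i) m gapₘ≢0))

    one-gap⇒scaledIneq : ∀ m₀ → gap m₀ ≢ 0ℚ → (∀ m → m ≢ m₀ → gap m ≡ 0ℚ) → ScaledIneq c b
    one-gap⇒scaledIneq m₀ gapₘ₀≢0 gap≡0 = m₀ , r , r>0 , c≡ , b≡
      where
      r = gap m₀ * 1/ nℚ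
      r>0 : 0ℚ < r
      r>0 = *-pos (≤∧≢⇒< (gap≥0 m₀) (≢-sym gapₘ₀≢0)) (1/-pos (ℕ→ℚ-pos (suc e)))
      dot≡ : ∀ x → dot c x ≡ b - r * slack nℚ x m₀
      dot≡ x = trans (dot-barycentric x) (cong (λ q → b - q) (trans
        (∑-single (λ m → barycentric x m * gap m) m₀
                  (λ m m≢m₀ → trans (cong (barycentric x m *_) (gap≡0 m m≢m₀)) (*-zeroʳ (barycentric x m))))
        (solve 3 (λ s i gap → (s :* i) :* gap := (gap :* i) :* s) refl (slack nℚ x m₀) (1/ nℚ) (gap m₀))))
      o = λ (_ : Fin (suc e)) → 0ℚ
      bound≡slack-o : ineqBound n m₀ ≡ slack nℚ o m₀
      bound≡slack-o = 0≡p-q⇒p≡q (trans (sym (dot-zeroʳ (ineqCoeff n m₀))) (dot-ineqCoeff m₀ o))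
      b≡ : b ≡ r * ineqBound n m₀
      b≡ = trans (0≡p-q⇒p≡q (trans (sym (dot-zeroʳ c)) (dot≡ o))) (cong (r *_) (sym bound≡slack-o))
      c≡ : ∀ j → c j ≡ r * ineqCoeff n m₀ j
      c≡ = dot-injectiveˡ λ x → begin
        dot c x                                        ≡⟨ dot≡ x ⟩
        b - r * slack nℚ x m₀                          ≡⟨ cong (_- r * slack nℚ x m₀) b≡ ⟩
        r * ineqBound n m₀ - r * slack nℚ x m₀
          ≡⟨ solve 3 (λ r b s → r :* b :- r :* s := r :* (b :- s)) refl r (ineqBound n m₀) (slack nℚ x m₀) ⟩
        r * (ineqBound n m₀ - slack nℚ x m₀)           ≡⟨ cong (r *_) (dot-ineqCoeff m₀ x) ⟨
        r * dot (ineqCoeff n m₀) x                     ≡⟨ dot-*ˡ r (ineqCoeff n m₀) x ⟨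
        dot (λ j → r * ineqCoeff n m₀ j) x             ∎
        where open ≡-Reasoning

  facet⇒scaledIneq : ∀ c b → FacetDefining P c b → ScaledIneq c b
  facet⇒scaledIneq c b (valid , k′ , P-dim′ , face-indep , face-¬indep) = by-cases (any? (λ m → ¬? (gap m ≟ℚ 0ℚ)))
    where
    open ValidInequality c b valid
    k′≡e : k′ ≡ e
    k′≡e = ℕ.suc-injective (sym (HasDim-unique {S = P} P-dimension P-dim′))
    by-cases-others : ∀ m₀ → gap m₀ ≢ 0ℚ → Dec (∃ λ m → m ≢ m₀ × gap m ≢ 0ℚ) → ScaledIneq c b
    by-cases-others m₀ gapₘ₀≢0 (yes (m , m≢m₀ , gapₘ≢0)) =
      contradiction (subst (HasAffIndep (FaceOf P c b)) k′≡e face-indep) (two-gaps⇒¬face-indep m₀ m m≢m₀ gapₘ₀≢0 gapₘ≢0)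
    by-cases-others m₀ gapₘ₀≢0 (no others) = one-gap⇒scaledIneq m₀ gapₘ₀≢0 λ m m≢m₀ →
      decidable-stable (gap m ≟ℚ 0ℚ) (λ gapₘ≢0 → others (m , m≢m₀ , gapₘ≢0))
    by-cases : Dec (∃ λ m → gap m ≢ 0ℚ) → ScaledIneq c b
    by-cases (yes (m₀ , gapₘ₀≢0)) = by-cases-others m₀ gapₘ₀≢0 (any? (λ m → ¬? (m ≟ m₀) ×-dec ¬? (gap m ≟ℚ 0ℚ)))
    by-cases (no all≡0) = contradiction (HasAffIndep-mono {S = P} (no-gap⇒P⊆face gap≡0) (proj₁ P-dim′)) face-¬indep
      where
      gap≡0 : ∀ m → gap m ≡ 0ℚ
      gap≡0 m = decidable-stable (gap m ≟ℚ 0ℚ) (λ gapₘ≢0 → all≡0 (m , gapₘ≢0))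

open import Data.Nat using (ℕ; _<_; _∸_)
open import Data.Nat.Divisibility using (_∣_)
open import Data.Fin using (Fin)
open import Data.Product using (Σ; _×_)
open import Data.Rational using (ℚ; 0ℚ; _*_)
open import Relation.Binary.PropositionalEquality using (_≡_)
open import Function.Bundles using (_⇔_)

open import Data.Nat using (zero; suc)
open import Data.Nat.Divisibility using (divides)
open import Data.Product using (_,_)
open import Function.Bundles using (mk⇔)
open import Relation.Binary.PropositionalEquality using (refl)
open Geometry using (ExtremePoint-resp-≈; ConvexHull-resp-≈)
open DualDegreePoints using (dualDegreePoint-slack-nonneg; vertex∈dualDegreePoints)

theorem2p1 : (n : ℕ) → 2 ∣ n → 0 < n →
    ((c : Point (n ∸ 1)) (b : ℚ) →
      FacetDefining (Q n) c b ⇔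
        Σ (Fin n) λ k → Σ ℚ λ r → (0ℚ Data.Rational.< r) ×
          ((∀ j → c j ≡ r * ineqCoeff n k j) × (b ≡ r * ineqBound n k)))
    × ((x : Point (n ∸ 1)) → ExtremePoint (Q n) x ⇔ Σ (Fin n) λ k → x ≈ₚ a n k)
theorem2p1 .(suc h Data.Nat.* 2) 2∣n@(divides (suc h) refl) _ =
  (λ c b → mk⇔ (facet⇒scaledIneq c b) (scaledIneq⇒facet c b)) ,
  (λ x → mk⇔ extreme⇒vertex λ (k , x≈aₖ) → ExtremePoint-resp-≈ ConvexHull-resp-≈ x≈aₖ (vertex-extreme k))
  where
  open Facets (h Data.Nat.* 2) (DualDegreePoint (suc h Data.Nat.* 2)) dualDegreePoint-slack-nonneg (vertex∈dualDegreePoints 2∣n)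
theorem2p1 .0 (divides zero refl) ()
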